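{- Let $f(t) = \sum_{m=1}^\infty \sum_{n=0}^\infty b_{m,n} t^{m} x^n$ be a formal power series in two variables $t$ and $x$ (with coefficients in a commutative ring, e.g. $\mathbb{C}$), and assume $b_{1,0} = 1$. Define $f^{(0)}(t) = t$ and $f^{(i)}(t) = f(f^{(i-1)}(t))$ for $i > 0$, where the composition substitutes $f^{(i-1)}(t)$ for the variable $t$ in $f$ while $x$ is left unchanged. Define a matrix $c$ by \[ c_{i,j} = [x^{j+1}] f^{(i)}(x) \qquad (i,j \geq 0), \] where $f^{(i)}(x)$ denotes the one-variable power series obtained by substituting $t = x$. Then \[ \det \left( (c_{i,j})_{i,j=0}^n\right) = \prod_{k=1}^n \left( \sum_{m=0}^k m!\, S(k+1,m+1)\, b_{2,0}^m\, b_{1,1}^{k-m} \right) \qquad (n = 0,1,2,\dots). \]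
   Context: $[x^j] g$ denotes the coefficient of $x^j$ in a power series $g$ in $x$. $S(a,b)$ denotes the Stirling number of the second kind, the number of partitions of a set of $a$ labeled objects into $b$ nonempty blocks. The convention $0^0 = 1$ is used in the powers $b_{2,0}^m b_{1,1}^{k-m}$. The empty product (for $n=0$) equals $1$. The iterates are well defined since $f$ has no term free of $t$. -}

module Defs where

open import Level using (Level)
open import Data.Nat using (ℕ; zero; suc; _∸_; _!)
open import Data.Fin using (Fin; zero; suc; toℕ; punchIn)
open import Algebra.Bundles using (CommutativeRing)

S : ℕ → ℕ → ℕ
S zero    zero    = 1
S zero    (suc k) = 0
S (suc n) zero    = 0
S (suc n) (suc k) = suc k Data.Nat.* S n (suc k) Data.Nat.+ S n k

module PS {c ℓ : Level} (R : CommutativeRing c ℓ) where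
  open CommutativeRing R using (Carrier; _+_; _*_; -_; 0#; 1#)

  fromℕ : ℕ → Carrier
  fromℕ zero    = 0#
  fromℕ (suc n) = 1# + fromℕ n

  -- powers, x ^ 0 = 1 (so 0^0 = 1)
  _^_ : Carrier → ℕ → Carrier
  x ^ zero  = 1#
  x ^ suc n = x * (x ^ n)

  sumTo : ℕ → (ℕ → Carrier) → Carrier
  sumTo zero    g = g 0
  sumTo (suc n) g = sumTo n g + g (suc n)

  prod1 : ℕ → (ℕ → Carrier) → Carrier
  prod1 zero    g = 1#
  prod1 (suc n) g = prod1 n g * g (suc n)

  sumFin : (n : ℕ) → (Fin n → Carrier) → Carrier
  sumFin zero    g = 0#
  sumFin (suc n) g = g zero + sumFin n (λ i → g (suc i))

  alt : ℕ → Carrier → Carrier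
  alt zero    x = x
  alt (suc k) x = - alt k x

  det : (n : ℕ) → (Fin n → Fin n → Carrier) → Carrier
  det zero    M = 1#
  det (suc n) M =
    sumFin (suc n) (λ j → alt (toℕ j) (M zero j * det n (λ i k → M (suc i) (punchIn j k))))

  -- Formal power series in t and x: coefficient of t^m x^n.
  Series : Set c
  Series = ℕ → ℕ → Carrier

  oneS : Series
  oneS zero zero = 1#
  oneS _    _    = 0#

  tS : Series
  tS (suc zero) zero = 1#
  tS _          _    = 0#

  mulS : Series → Series → Series
  mulS p q m n = sumTo m (λ a → sumTo n (λ e → p a e * q (m ∸ a) (n ∸ e)))

  powS : Series → ℕ → Series
  powS g zero    = oneS
  powS g (suc k) = mulS g (powS g k)

  -- f(t) = Σ_{m≥1} Σ_{n≥0} b m n t^m x^n  (b 0 n is ignored: no t-free term)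
  fS : (ℕ → ℕ → Carrier) → Series
  fS b zero    n = 0#
  fS b (suc m) n = b (suc m) n

  -- composition f(g(t)) with x unchanged, for g without t-free term
  -- (then g^k has t-order ≥ k, so only k ≤ m contributes to t^m)
  compS : Series → Series → Series
  compS f g m n = sumTo m (λ k → sumTo n (λ l → f k l * powS g k m (n ∸ l)))

  iter : (ℕ → ℕ → Carrier) → ℕ → Series
  iter b zero    = tS
  iter b (suc i) = compS (fS b) (iter b i)

  -- [x^j] h(x), i.e. after substituting t = x
  diagCoeff : Series → ℕ → Carrier
  diagCoeff h j = sumTo j (λ m → h m (j ∸ m))

  cMat : (ℕ → ℕ → Carrier) → ℕ → ℕ → Carrier
  cMat b i j = diagCoeff (iter b i) (suc j)

  factor : (ℕ → ℕ → Carrier) → ℕ → Carrier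
  factor b k = sumTo k (λ m → fromℕ ((m !) Data.Nat.* S (suc k) (suc m)) * ((b 2 0 ^ m) * (b 1 1 ^ (k ∸ m))))

{-# OPTIONS --safe #-}
-- Put ψ₀ = t and ψₖ₊₁ = ψₖ ∘ f − ψₖ. Because composition is associative, the k-th forward difference
-- in i of the rows (c_{i,j})_j is ([x^{j+1}] ψₖ(f^{(i)}(x)))_j. Replacing every row k by the k-th
-- difference of rows 0, …, k is a unitriangular row operation, so the determinant is that of
-- ([x^{j+1}] ψᵢ(x))_{i,j}. Since f = t + b₂₀ t² + b₁₁ t x + (terms of total degree ≥ 3), ψₖ has no
-- terms of total degree ≤ k, so this matrix is upper triangular; and for m + n = k + 2,
--   [tᵐxⁿ] ψₖ₊₁ = m b₁₁ [tᵐxⁿ⁻¹] ψₖ + (m − 1) b₂₀ [tᵐ⁻¹xⁿ] ψₖ,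
-- the recurrence solved by [tᵐxⁿ] ψₖ = (m − 1)! S(k + 1, m) b₂₀ᵐ⁻¹ b₁₁ⁿ for m + n = k + 1, m ≥ 1 (and 0
-- for m = 0). Summing over m + n = k + 1 gives the diagonal entry [x^{k+1}] ψₖ(x), the k-th factor.
module Submission where

open import Defs
open import Level using (Level)
open import Data.Nat using (ℕ; suc)
open import Data.Fin using (toℕ)
open import Algebra.Bundles using (CommutativeRing)

open import Data.Nat as ℕ using (zero; _∸_; z≤n; s≤s; _<ᵇ_; pred; _!)
  renaming (_≤_ to _≤ℕ_; _<_ to _<ℕ_; _+_ to _+ℕ_; _*_ to _*ℕ_)
import Data.Nat.Properties as ℕ
open import Data.Fin using (Fin; zero; suc; punchIn; punchOut)
import Data.Fin.Properties as Fin
open import Data.Vec.Functional using (insertAt)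
import Data.Vec.Functional.Properties as Vecₚ
open import Data.Bool using (true; false; if_then_else_)
open import Data.Empty using (⊥-elim)
open import Data.Sum using (_⊎_; inj₁; inj₂)
open import Data.Product using (_×_; _,_)
open import Function using (_∘_)
open import Relation.Binary.PropositionalEquality as ≡ using (_≡_; _≢_)
open import Relation.Binary.Definitions using (tri<; tri≈; tri>)
open import Relation.Nullary using (yes; no)
open import Algebra.Structures using (IsCommutativeRing)
import Algebra.Properties.CommutativeSemigroup

<⇒<ᵇ≡true : ∀ {m n} → m <ℕ n → (m <ᵇ n) ≡ true
<⇒<ᵇ≡true {zero}  {suc n} _         = ≡.refl
<⇒<ᵇ≡true {suc m} {suc n} (s≤s m<n) = <⇒<ᵇ≡true m<n

≥⇒<ᵇ≡false : ∀ {m n} → n ≤ℕ m → (m <ᵇ n) ≡ false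
≥⇒<ᵇ≡false {m}     {zero}  _         = ≡.refl
≥⇒<ᵇ≡false {suc m} {suc n} (s≤s n≤m) = ≥⇒<ᵇ≡false n≤m

∸-<-bound : ∀ {m k j a} → m ≤ℕ k +ℕ j → j <ℕ a → a ≤ℕ m → m ∸ a <ℕ k
∸-<-bound {m} {k} {j} {a} m≤k+j j<a a≤m = ℕ.+-cancelʳ-< a (m ∸ a) k
  (≡.subst (_<ℕ k +ℕ a) (≡.sym (ℕ.m∸n+n≡m a≤m)) (ℕ.≤-<-trans m≤k+j (ℕ.+-monoʳ-< k j<a)))

nearDiagonal : ∀ {k l m n} → k ≤ℕ m → l ≤ℕ n → m +ℕ n ≤ℕ suc (k +ℕ l) →
  (m ≡ k × n ≡ l) ⊎ (m ≡ k × n ≡ suc l) ⊎ (m ≡ suc k × n ≡ l)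
nearDiagonal {k} {l} {m} {n} k≤m l≤n m+n≤ with m ℕ.≟ k | n ℕ.≟ l
... | yes m≡k | yes n≡l = inj₁ (m≡k , n≡l)
... | yes ≡.refl | no n≢l = inj₂ (inj₁ (≡.refl , ℕ.≤-antisym n≤1+l (ℕ.≤∧≢⇒< l≤n (n≢l ∘ ≡.sym))))
  where
  n≤1+l : n ≤ℕ suc l
  n≤1+l = ℕ.+-cancelˡ-≤ m n (suc l) (≡.subst (m +ℕ n ≤ℕ_) (≡.sym (ℕ.+-suc m l)) m+n≤)
... | no m≢k | _ = inj₂ (inj₂ (ℕ.≤-antisym m≤1+k 1+k≤m , n≡l))
  where
  1+k≤m : suc k ≤ℕ m
  1+k≤m = ℕ.≤∧≢⇒< k≤m (m≢k ∘ ≡.sym)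
  n≡l : n ≡ l
  n≡l = ℕ.≤-antisym (ℕ.+-cancelˡ-≤ (suc k) n l (ℕ.≤-trans (ℕ.+-monoˡ-≤ n 1+k≤m) m+n≤)) l≤n
  m≤1+k : m ≤ℕ suc k
  m≤1+k = ℕ.+-cancelʳ-≤ l m (suc k) (≡.subst (λ z → m +ℕ z ≤ℕ suc (k +ℕ l)) n≡l m+n≤)

S-beyond : ∀ n k → n <ℕ k → S n k ≡ 0
S-beyond zero    (suc k) _         = ≡.refl
S-beyond (suc n) (suc k) (s≤s n<k) rewrite S-beyond n (suc k) (ℕ.m≤n⇒m≤1+n n<k) | S-beyond n k n<k =
  ≡.trans (ℕ.+-identityʳ (suc k *ℕ 0)) (ℕ.*-zeroʳ (suc k))

module Sums {c ℓ : Level} (R : CommutativeRing c ℓ) where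
  open CommutativeRing R hiding (zero)
  open PS R
  open import Relation.Binary.Reasoning.Setoid setoid
  open import Algebra.Properties.Ring ring using (-‿+-comm; -0#≈0#)
  open import Algebra.Properties.CommutativeSemigroup +-commutativeSemigroup
    using () renaming (interchange to +-interchange)

  0#+0#≈0# : 0# + 0# ≈ 0#
  0#+0#≈0# = +-identityˡ 0#

  sumTo-cong≤ : ∀ n {g h : ℕ → Carrier} → (∀ k → k ≤ℕ n → g k ≈ h k) → sumTo n g ≈ sumTo n h
  sumTo-cong≤ zero    g≈h = g≈h 0 z≤n
  sumTo-cong≤ (suc n) g≈h = +-cong (sumTo-cong≤ n (λ k k≤n → g≈h k (ℕ.m≤n⇒m≤1+n k≤n))) (g≈h (suc n) ℕ.≤-refl)

  sumTo-cong : ∀ n {g h : ℕ → Carrier} → (∀ k → g k ≈ h k) → sumTo n g ≈ sumTo n h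
  sumTo-cong n g≈h = sumTo-cong≤ n (λ k _ → g≈h k)

  sumTo-+ : ∀ n (g h : ℕ → Carrier) → sumTo n (λ k → g k + h k) ≈ sumTo n g + sumTo n h
  sumTo-+ zero    g h = refl
  sumTo-+ (suc n) g h = trans (+-congʳ (sumTo-+ n g h)) (+-interchange _ _ _ _)

  sumTo-neg : ∀ n (g : ℕ → Carrier) → - sumTo n g ≈ sumTo n (λ k → - g k)
  sumTo-neg zero    g = refl
  sumTo-neg (suc n) g = trans (sym (-‿+-comm _ _)) (+-congʳ (sumTo-neg n g))

  sumTo-sub : ∀ n (g h : ℕ → Carrier) → sumTo n (λ k → g k - h k) ≈ sumTo n g - sumTo n h
  sumTo-sub n g h = trans (sumTo-+ n g (λ k → - h k)) (+-congˡ (sym (sumTo-neg n h)))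

  sumTo-*ˡ : ∀ n x (g : ℕ → Carrier) → x * sumTo n g ≈ sumTo n (λ k → x * g k)
  sumTo-*ˡ zero    x g = refl
  sumTo-*ˡ (suc n) x g = trans (distribˡ x _ _) (+-congʳ (sumTo-*ˡ n x g))

  sumTo-*ʳ : ∀ n x (g : ℕ → Carrier) → sumTo n g * x ≈ sumTo n (λ k → g k * x)
  sumTo-*ʳ zero    x g = refl
  sumTo-*ʳ (suc n) x g = trans (distribʳ x _ _) (+-congʳ (sumTo-*ʳ n x g))

  sumTo-≈0 : ∀ n {g : ℕ → Carrier} → (∀ k → k ≤ℕ n → g k ≈ 0#) → sumTo n g ≈ 0#
  sumTo-≈0 zero    g≈0 = g≈0 0 z≤n
  sumTo-≈0 (suc n) g≈0 =
    trans (+-cong (sumTo-≈0 n (λ k k≤n → g≈0 k (ℕ.m≤n⇒m≤1+n k≤n))) (g≈0 (suc n) ℕ.≤-refl)) 0#+0#≈0#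

  sumTo-suc : ∀ n (g : ℕ → Carrier) → sumTo (suc n) g ≈ g 0 + sumTo n (λ k → g (suc k))
  sumTo-suc zero    g = refl
  sumTo-suc (suc n) g = trans (+-congʳ (sumTo-suc n g)) (+-assoc _ _ _)

  sumTo-reverse : ∀ n (g : ℕ → Carrier) → sumTo n g ≈ sumTo n (λ k → g (n ∸ k))
  sumTo-reverse zero    g = refl
  sumTo-reverse (suc n) g = begin
    sumTo n g + g (suc n)                  ≈⟨ +-comm _ _ ⟩
    g (suc n) + sumTo n g                  ≈⟨ +-congˡ (sumTo-reverse n g) ⟩
    g (suc n) + sumTo n (λ k → g (n ∸ k))  ≈⟨ sumTo-suc n (λ k → g (suc n ∸ k)) ⟨
    sumTo (suc n) (λ k → g (suc n ∸ k))    ∎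

  sumTo-single : ∀ n k₀ {g : ℕ → Carrier} → k₀ ≤ℕ n →
    (∀ k → k ≤ℕ n → k ≢ k₀ → g k ≈ 0#) → sumTo n g ≈ g k₀
  sumTo-single zero    zero z≤n g≈0 = refl
  sumTo-single (suc n) k₀ k₀≤ g≈0 with k₀ ℕ.≟ suc n
  ... | yes ≡.refl = trans (+-congʳ (sumTo-≈0 n λ k k≤n → g≈0 k (ℕ.m≤n⇒m≤1+n k≤n) (ℕ.<⇒≢ (s≤s k≤n))))
                           (+-identityˡ _)
  ... | no k₀≢ = trans (+-cong (sumTo-single n k₀ (ℕ.≤-pred (ℕ.≤∧≢⇒< k₀≤ k₀≢))
                                 (λ k k≤n → g≈0 k (ℕ.m≤n⇒m≤1+n k≤n)))
                               (g≈0 (suc n) ℕ.≤-refl (k₀≢ ∘ ≡.sym)))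
                       (+-identityʳ _)

  sumTo-extend : ∀ n m {g : ℕ → Carrier} → n ≤ℕ m →
    (∀ k → n <ℕ k → k ≤ℕ m → g k ≈ 0#) → sumTo m g ≈ sumTo n g
  sumTo-extend n zero    z≤n g≈0 = refl
  sumTo-extend n (suc m) n≤ g≈0 with n ℕ.≟ suc m
  ... | yes ≡.refl = refl
  ... | no n≢ = trans (+-cong (sumTo-extend n m (ℕ.≤-pred (ℕ.≤∧≢⇒< n≤ n≢))
                                (λ k n<k k≤m → g≈0 k n<k (ℕ.m≤n⇒m≤1+n k≤m)))
                              (g≈0 (suc m) (ℕ.≤∧≢⇒< n≤ n≢) ℕ.≤-refl))
                      (+-identityʳ _)

  sumTo-triangle : ∀ n (g : ℕ → ℕ → Carrier) →
    sumTo n (λ a → sumTo (n ∸ a) (g a)) ≈ sumTo n (λ s → sumTo s (λ a → g a (s ∸ a)))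
  sumTo-triangle zero    g = refl
  sumTo-triangle (suc n) g = begin
    sumTo n (λ a → sumTo (suc n ∸ a) (g a)) + sumTo (n ∸ n) (g (suc n))
      ≈⟨ +-cong (sumTo-cong≤ n (λ a a≤n → reflexive (≡.cong (λ z → sumTo z (g a)) (ℕ.+-∸-assoc 1 a≤n))))
                (reflexive (≡.cong (λ z → sumTo z (g (suc n))) (ℕ.n∸n≡0 n))) ⟩
    sumTo n (λ a → sumTo (n ∸ a) (g a) + g a (suc (n ∸ a))) + g (suc n) 0
      ≈⟨ +-congʳ (sumTo-+ n _ _) ⟩
    (sumTo n (λ a → sumTo (n ∸ a) (g a)) + sumTo n (λ a → g a (suc (n ∸ a)))) + g (suc n) 0
      ≈⟨ +-assoc _ _ _ ⟩
    sumTo n (λ a → sumTo (n ∸ a) (g a)) + (sumTo n (λ a → g a (suc (n ∸ a))) + g (suc n) 0)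
      ≈⟨ +-cong (sumTo-triangle n g)
                (+-cong (sumTo-cong≤ n (λ a a≤n → reflexive (≡.cong (g a) (≡.sym (ℕ.+-∸-assoc 1 a≤n)))))
                        (reflexive (≡.cong (g (suc n)) (≡.sym (ℕ.n∸n≡0 n))))) ⟩
    sumTo n (λ s → sumTo s (λ a → g a (s ∸ a))) + sumTo (suc n) (λ a → g a (suc n ∸ a)) ∎

  sumTo²-* : ∀ m n m′ n′ (F G : ℕ → ℕ → Carrier) →
    sumTo m (λ a → sumTo n (F a)) * sumTo m′ (λ a′ → sumTo n′ (G a′)) ≈
    sumTo m (λ a → sumTo n (λ e → sumTo m′ (λ a′ → sumTo n′ (λ e′ → F a e * G a′ e′))))
  sumTo²-* m n m′ n′ F G = begin
    sumTo m (λ a → sumTo n (F a)) * ΣG          ≈⟨ sumTo-*ʳ m ΣG _ ⟩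
    sumTo m (λ a → sumTo n (F a) * ΣG)          ≈⟨ sumTo-cong m (λ a → sumTo-*ʳ n ΣG _) ⟩
    sumTo m (λ a → sumTo n (λ e → F a e * ΣG))
      ≈⟨ sumTo-cong m (λ a → sumTo-cong n (λ e →
           trans (sumTo-*ˡ m′ (F a e) _) (sumTo-cong m′ (λ a′ → sumTo-*ˡ n′ (F a e) _)))) ⟩
    sumTo m (λ a → sumTo n (λ e → sumTo m′ (λ a′ → sumTo n′ (λ e′ → F a e * G a′ e′)))) ∎
    where
    ΣG : Carrier
    ΣG = sumTo m′ (λ a′ → sumTo n′ (G a′))

  prod1-cong : ∀ n {g h : ℕ → Carrier} → (∀ k → g k ≈ h k) → prod1 n g ≈ prod1 n h
  prod1-cong zero    g≈h = refl
  prod1-cong (suc n) g≈h = *-cong (prod1-cong n g≈h) (g≈h (suc n))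

  prod1-suc : ∀ n (g : ℕ → Carrier) → prod1 (suc n) g ≈ g 1 * prod1 n (λ k → g (suc k))
  prod1-suc zero    g = trans (*-identityˡ _) (sym (*-identityʳ _))
  prod1-suc (suc n) g = trans (*-congʳ (prod1-suc n g)) (*-assoc _ _ _)

  sumFin-cong : ∀ n {g h : Fin n → Carrier} → (∀ k → g k ≈ h k) → sumFin n g ≈ sumFin n h
  sumFin-cong zero    g≈h = refl
  sumFin-cong (suc n) g≈h = +-cong (g≈h zero) (sumFin-cong n (g≈h ∘ suc))

  sumFin-+ : ∀ n (g h : Fin n → Carrier) → sumFin n (λ k → g k + h k) ≈ sumFin n g + sumFin n h
  sumFin-+ zero    g h = sym 0#+0#≈0#
  sumFin-+ (suc n) g h = trans (+-congˡ (sumFin-+ n _ _)) (+-interchange _ _ _ _)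

  sumFin-≈0 : ∀ n {g : Fin n → Carrier} → (∀ k → g k ≈ 0#) → sumFin n g ≈ 0#
  sumFin-≈0 zero    g≈0 = refl
  sumFin-≈0 (suc n) g≈0 = trans (+-cong (g≈0 zero) (sumFin-≈0 n (g≈0 ∘ suc))) 0#+0#≈0#

  sumFin-neg : ∀ n (g : Fin n → Carrier) → - sumFin n g ≈ sumFin n (λ k → - g k)
  sumFin-neg zero    g = -0#≈0#
  sumFin-neg (suc n) g = trans (sym (-‿+-comm _ _)) (+-congˡ (sumFin-neg n (g ∘ suc)))

  sumFin-sub : ∀ n (g h : Fin n → Carrier) → sumFin n (λ j → g j - h j) ≈ sumFin n g - sumFin n h
  sumFin-sub n g h = trans (sumFin-+ n g (λ j → - h j)) (+-congˡ (sym (sumFin-neg n h)))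

  sumFin-*ˡ : ∀ n x (g : Fin n → Carrier) → x * sumFin n g ≈ sumFin n (λ k → x * g k)
  sumFin-*ˡ zero    x g = zeroʳ x
  sumFin-*ˡ (suc n) x g = trans (distribˡ x _ _) (+-congˡ (sumFin-*ˡ n x _))

  sumFin-insertAt : ∀ n (j : Fin (suc n)) (g : Fin n → Carrier) →
    sumFin (suc n) (insertAt g j 0#) ≈ sumFin n g
  sumFin-insertAt n       zero    g = +-identityˡ _
  sumFin-insertAt (suc n) (suc j) g = +-congˡ (sumFin-insertAt n j (g ∘ suc))

  δ : ℕ → ℕ → Carrier → Carrier
  δ zero    zero    x = x
  δ zero    (suc b) x = 0#
  δ (suc a) zero    x = 0#
  δ (suc a) (suc b) x = δ a b x

  δ-refl : ∀ a x → δ a a x ≡ x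
  δ-refl zero    x = ≡.refl
  δ-refl (suc a) x = δ-refl a x

  δ-≢ : ∀ a b x → a ≢ b → δ a b x ≡ 0#
  δ-≢ zero    zero    x a≢b = ⊥-elim (a≢b ≡.refl)
  δ-≢ zero    (suc b) x _   = ≡.refl
  δ-≢ (suc a) zero    x _   = ≡.refl
  δ-≢ (suc a) (suc b) x a≢b = δ-≢ a b x (a≢b ∘ ≡.cong suc)

  δ-sym : ∀ a b x → δ a b x ≡ δ b a x
  δ-sym zero    zero    x = ≡.refl
  δ-sym zero    (suc b) x = ≡.refl
  δ-sym (suc a) zero    x = ≡.refl
  δ-sym (suc a) (suc b) x = δ-sym a b x

  δ-⇔ : ∀ a a′ b b′ x → (a ≡ a′ → b ≡ b′) → (b ≡ b′ → a ≡ a′) → δ a a′ x ≡ δ b b′ x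
  δ-⇔ a a′ b b′ x to from with a ℕ.≟ a′
  ... | yes ≡.refl = ≡.trans (δ-refl a x) (≡.sym (≡.subst (λ z → δ b z x ≡ x) (to ≡.refl) (δ-refl b x)))
  ... | no a≢a′    = ≡.trans (δ-≢ a a′ x a≢a′) (≡.sym (δ-≢ b b′ x (a≢a′ ∘ from)))

  δ-cong : ∀ a b {x y} → x ≈ y → δ a b x ≈ δ a b y
  δ-cong zero    zero    x≈y = x≈y
  δ-cong zero    (suc b) _   = refl
  δ-cong (suc a) zero    _   = refl
  δ-cong (suc a) (suc b) x≈y = δ-cong a b x≈y

  δ-0# : ∀ a b → δ a b 0# ≈ 0#
  δ-0# a b with a ℕ.≟ b
  ... | yes ≡.refl = reflexive (δ-refl a 0#)
  ... | no a≢b     = reflexive (δ-≢ a b 0# a≢b)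

  δ-+ : ∀ a b x y → δ a b (x + y) ≈ δ a b x + δ a b y
  δ-+ zero    zero    x y = refl
  δ-+ zero    (suc b) x y = sym 0#+0#≈0#
  δ-+ (suc a) zero    x y = sym 0#+0#≈0#
  δ-+ (suc a) (suc b) x y = δ-+ a b x y

  δ-*ˡ : ∀ a b x y → x * δ a b y ≈ δ a b (x * y)
  δ-*ˡ zero    zero    x y = refl
  δ-*ˡ zero    (suc b) x y = zeroʳ x
  δ-*ˡ (suc a) zero    x y = zeroʳ x
  δ-*ˡ (suc a) (suc b) x y = δ-*ˡ a b x y

  δ-*ʳ : ∀ a b x y → δ a b y * x ≈ δ a b (y * x)
  δ-*ʳ a b x y = trans (*-comm _ _) (trans (δ-*ˡ a b x y) (δ-cong a b (*-comm x y)))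

  sumTo-δ : ∀ m k₀ (g : ℕ → Carrier) → k₀ ≤ℕ m → sumTo m (λ k → δ k k₀ (g k)) ≈ g k₀
  sumTo-δ m k₀ g k₀≤m = trans (sumTo-single m k₀ k₀≤m (λ k _ k≢k₀ → reflexive (δ-≢ k k₀ (g k) k≢k₀)))
                              (reflexive (δ-refl k₀ (g k₀)))

  sumTo-δ-beyond : ∀ m k₀ (g : ℕ → Carrier) → m <ℕ k₀ → sumTo m (λ k → δ k k₀ (g k)) ≈ 0#
  sumTo-δ-beyond m k₀ g m<k₀ = sumTo-≈0 m λ k k≤m → reflexive (δ-≢ k k₀ (g k) (ℕ.<⇒≢ (ℕ.≤-<-trans k≤m m<k₀)))

  sumTo-δ-comm : ∀ n a b (h : ℕ → Carrier) → sumTo n (λ e → δ a b (h e)) ≈ δ a b (sumTo n h)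
  sumTo-δ-comm zero    a b h = refl
  sumTo-δ-comm (suc n) a b h = trans (+-congʳ (sumTo-δ-comm n a b h)) (sym (δ-+ a b _ _))

  sumTo²-δ : ∀ m n k l x (H : ℕ → ℕ → Carrier) → k ≤ℕ m → l ≤ℕ n →
    sumTo m (λ k′ → sumTo n (λ l′ → δ k′ k (δ l′ l x) * H k′ l′)) ≈ x * H k l
  sumTo²-δ m n k l x H k≤m l≤n = begin
    sumTo m (λ k′ → sumTo n (λ l′ → δ k′ k (δ l′ l x) * H k′ l′))
      ≈⟨ sumTo-cong m (λ k′ → sumTo-cong n (λ l′ → trans (δ-*ʳ k′ k _ _) (δ-cong k′ k (δ-*ʳ l′ l _ _)))) ⟩
    sumTo m (λ k′ → sumTo n (λ l′ → δ k′ k (δ l′ l (x * H k′ l′))))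
      ≈⟨ sumTo-cong m (λ k′ → sumTo-δ-comm n k′ k _) ⟩
    sumTo m (λ k′ → δ k′ k (sumTo n (λ l′ → δ l′ l (x * H k′ l′))))
      ≈⟨ sumTo-δ m k _ k≤m ⟩
    sumTo n (λ l′ → δ l′ l (x * H k l′))
      ≈⟨ sumTo-δ n l _ l≤n ⟩
    x * H k l ∎

  sumTo²-δ-beyond₁ : ∀ m n k l x (H : ℕ → ℕ → Carrier) → m <ℕ k →
    sumTo m (λ k′ → sumTo n (λ l′ → δ k′ k (δ l′ l x) * H k′ l′)) ≈ 0#
  sumTo²-δ-beyond₁ m n k l x H m<k = trans
    (sumTo-cong m (λ k′ → trans (sumTo-cong n (λ l′ → δ-*ʳ k′ k _ _)) (sumTo-δ-comm n k′ k _)))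
    (sumTo-δ-beyond m k _ m<k)

  sumTo²-δ-beyond₂ : ∀ m n k l x (H : ℕ → ℕ → Carrier) → n <ℕ l →
    sumTo m (λ k′ → sumTo n (λ l′ → δ k′ k (δ l′ l x) * H k′ l′)) ≈ 0#
  sumTo²-δ-beyond₂ m n k l x H n<l = sumTo-≈0 m λ k′ _ → begin
    sumTo n (λ l′ → δ k′ k (δ l′ l x) * H k′ l′)
      ≈⟨ sumTo-cong n (λ l′ → trans (δ-*ʳ k′ k _ _) (δ-cong k′ k (δ-*ʳ l′ l _ _))) ⟩
    sumTo n (λ l′ → δ k′ k (δ l′ l (x * H k′ l′)))  ≈⟨ sumTo-δ-comm n k′ k _ ⟩
    δ k′ k (sumTo n (λ l′ → δ l′ l (x * H k′ l′)))  ≈⟨ δ-cong k′ k (sumTo-δ-beyond n l _ n<l) ⟩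
    δ k′ k 0#                                        ≈⟨ δ-0# k′ k ⟩
    0# ∎

  sumTo-pair : ∀ n k₁ k₂ {g : ℕ → Carrier} → k₁ ≢ k₂ → k₁ ≤ℕ n → k₂ ≤ℕ n →
    (∀ k → k ≤ℕ n → k ≢ k₁ → k ≢ k₂ → g k ≈ 0#) → sumTo n g ≈ g k₁ + g k₂
  sumTo-pair n k₁ k₂ {g} k₁≢k₂ k₁≤n k₂≤n g≈0 = begin
    sumTo n g                                                    ≈⟨ sumTo-cong≤ n split ⟩
    sumTo n (λ k → δ k k₁ (g k) + δ k k₂ (g k))                  ≈⟨ sumTo-+ n _ _ ⟩
    sumTo n (λ k → δ k k₁ (g k)) + sumTo n (λ k → δ k k₂ (g k))  ≈⟨ +-cong (sumTo-δ n k₁ g k₁≤n) (sumTo-δ n k₂ g k₂≤n) ⟩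
    g k₁ + g k₂                                                  ∎
    where
    split : ∀ k → k ≤ℕ n → g k ≈ δ k k₁ (g k) + δ k k₂ (g k)
    split k k≤n with k ℕ.≟ k₁ | k ℕ.≟ k₂
    ... | yes ≡.refl | _ = sym (trans (+-cong (reflexive (δ-refl k _)) (reflexive (δ-≢ k k₂ _ k₁≢k₂))) (+-identityʳ _))
    ... | no k≢k₁ | yes ≡.refl = sym (trans (+-cong (reflexive (δ-≢ k k₁ _ k≢k₁)) (reflexive (δ-refl k _))) (+-identityˡ _))
    ... | no k≢k₁ | no k≢k₂ = trans (g≈0 k k≤n k≢k₁ k≢k₂)
      (sym (trans (+-cong (reflexive (δ-≢ k k₁ _ k≢k₁)) (reflexive (δ-≢ k k₂ _ k≢k₂))) 0#+0#≈0#))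

module Determinant {c ℓ : Level} (R : CommutativeRing c ℓ) where
  open CommutativeRing R hiding (zero)
  open PS R
  open Sums R
  open import Relation.Binary.Reasoning.Setoid setoid
  open import Algebra.Properties.Ring ring
    using (-‿distribʳ-*; -0#≈0#; -‿involutive; -‿+-comm; x[y-z]≈xy-xz; [y-z]x≈yx-zx)
  open import Algebra.Properties.CommutativeSemigroup *-commutativeSemigroup using (x∙yz≈y∙xz)

  Matrix : ℕ → Set c
  Matrix n = Fin n → Fin n → Carrier

  minor : ∀ {n} → Matrix (suc n) → Fin (suc n) → Matrix n
  minor M j i k = M (suc i) (punchIn j k)

  alt-cong : ∀ k {x y} → x ≈ y → alt k x ≈ alt k y
  alt-cong zero    x≈y = x≈y
  alt-cong (suc k) x≈y = -‿cong (alt-cong k x≈y)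

  alt-neg : ∀ k x → alt k (- x) ≈ - alt k x
  alt-neg zero    x = refl
  alt-neg (suc k) x = -‿cong (alt-neg k x)

  alt-+ : ∀ k x y → alt k (x + y) ≈ alt k x + alt k y
  alt-+ zero    x y = refl
  alt-+ (suc k) x y = trans (-‿cong (alt-+ k x y)) (sym (-‿+-comm _ _))

  alt-sub : ∀ k x y → alt k (x - y) ≈ alt k x - alt k y
  alt-sub k x y = trans (alt-+ k x (- y)) (+-congˡ (alt-neg k y))

  alt-*ˡ : ∀ k x y → x * alt k y ≈ alt k (x * y)
  alt-*ˡ zero    x y = refl
  alt-*ˡ (suc k) x y = trans (sym (-‿distribʳ-* x _)) (-‿cong (alt-*ˡ k x y))

  alt-0# : ∀ k → alt k 0# ≈ 0#
  alt-0# zero    = refl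
  alt-0# (suc k) = trans (-‿cong (alt-0# k)) -0#≈0#

  alt-sumFin : ∀ n k (g : Fin n → Carrier) → alt k (sumFin n g) ≈ sumFin n (λ b → alt k (g b))
  alt-sumFin zero    k g = alt-0# k
  alt-sumFin (suc n) k g = trans (alt-+ k _ _) (+-congˡ (alt-sumFin n k _))

  det-cong : ∀ n {M M′ : Matrix n} → (∀ i j → M i j ≈ M′ i j) → det n M ≈ det n M′
  det-cong zero    M≈M′ = refl
  det-cong (suc n) M≈M′ = sumFin-cong (suc n) λ j →
    alt-cong (toℕ j) (*-cong (M≈M′ zero j) (det-cong n (λ i k → M≈M′ (suc i) (punchIn j k))))

  det-zeroColumn₀ : ∀ n (M : Matrix (suc n)) → (∀ i → M i zero ≈ 0#) → det (suc n) M ≈ 0#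
  det-zeroColumn₀ zero    M M·₀≈0 = trans (+-identityʳ _) (trans (*-congʳ (M·₀≈0 zero)) (zeroˡ _))
  det-zeroColumn₀ (suc n) M M·₀≈0 =
    sumFin-≈0 (suc (suc n)) (λ j → trans (alt-cong (toℕ j) (entry≈0 j)) (alt-0# (toℕ j)))
    where
    entry≈0 : ∀ j → M zero j * det (suc n) (minor M j) ≈ 0#
    entry≈0 zero    = trans (*-congʳ (M·₀≈0 zero)) (zeroˡ _)
    entry≈0 (suc j) = trans (*-congˡ (det-zeroColumn₀ _ (minor M (suc j)) (M·₀≈0 ∘ suc))) (zeroʳ _)

  det-upperTriangular : ∀ n (U : ℕ → ℕ → Carrier) → (∀ i j → j <ℕ i → U i j ≈ 0#) →
    det (suc n) (λ i j → U (toℕ i) (toℕ j)) ≈ U 0 0 * prod1 n (λ k → U k k)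
  det-upperTriangular zero    U U≈0 = +-identityʳ _
  det-upperTriangular (suc n) U U≈0 = begin
    U 0 0 * det (suc n) (λ i k → U (suc (toℕ i)) (suc (toℕ k))) + offDiagonal
      ≈⟨ +-cong (*-congˡ (det-upperTriangular n (λ i j → U (suc i) (suc j))
                            (λ i j j<i → U≈0 (suc i) (suc j) (s≤s j<i))))
                offDiagonal≈0 ⟩
    U 0 0 * (U 1 1 * prod1 n (λ k → U (suc k) (suc k))) + 0#  ≈⟨ +-identityʳ _ ⟩
    U 0 0 * (U 1 1 * prod1 n (λ k → U (suc k) (suc k)))       ≈⟨ *-congˡ (prod1-suc n (λ k → U k k)) ⟨
    U 0 0 * prod1 (suc n) (λ k → U k k)                        ∎
    where
    M : Matrix (suc (suc n))
    M i j = U (toℕ i) (toℕ j)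
    offDiagonal : Carrier
    offDiagonal = sumFin (suc n) (λ j → alt (suc (toℕ j)) (M zero (suc j) * det (suc n) (minor M (suc j))))
    offDiagonal≈0 : offDiagonal ≈ 0#
    offDiagonal≈0 = sumFin-≈0 (suc n) λ j → trans
      (alt-cong (suc (toℕ j)) (trans (*-congˡ {M zero (suc j)} (det-zeroColumn₀ n (minor M (suc j))
                                                 (λ i → U≈0 (suc (toℕ i)) 0 (s≤s z≤n))))
                                     (zeroʳ _)))
      (alt-0# (suc (toℕ j)))

  punchIn-punchOut-swap : ∀ {m} (a b : Fin (suc (suc m))) (a≢b : a ≢ b) (b≢a : b ≢ a) (l : Fin m) →
    punchIn a (punchIn (punchOut a≢b) l) ≡ punchIn b (punchIn (punchOut b≢a) l)
  punchIn-punchOut-swap zero    zero    a≢b _ l = ⊥-elim (a≢b ≡.refl)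
  punchIn-punchOut-swap zero    (suc b) _   _ l = ≡.refl
  punchIn-punchOut-swap (suc a) zero    _   _ l = ≡.refl
  punchIn-punchOut-swap {suc m} (suc a) (suc b) _ _ zero    = ≡.refl
  punchIn-punchOut-swap {suc m} (suc a) (suc b) a≢b b≢a (suc l) =
    ≡.cong suc (punchIn-punchOut-swap a b (a≢b ∘ ≡.cong suc) (b≢a ∘ ≡.cong suc) l)

  alt-punchOut-swap : ∀ {m} (a b : Fin (suc m)) (a≢b : a ≢ b) (b≢a : b ≢ a) x →
    alt (toℕ a) (alt (toℕ (punchOut a≢b)) x) ≈ - alt (toℕ b) (alt (toℕ (punchOut b≢a)) x)
  alt-punchOut-swap zero zero a≢b _ x = ⊥-elim (a≢b ≡.refl)
  alt-punchOut-swap {suc m} zero    (suc b) _ _ x = sym (-‿involutive _)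
  alt-punchOut-swap {suc m} (suc a) zero    _ _ x = refl
  alt-punchOut-swap {suc m} (suc a) (suc b) a≢b b≢a x = begin
    - alt (toℕ a) (- alt (toℕ (punchOut a≢b′)) x)   ≈⟨ -‿cong (alt-neg (toℕ a) _) ⟩
    - - alt (toℕ a) (alt (toℕ (punchOut a≢b′)) x)   ≈⟨ -‿involutive _ ⟩
    alt (toℕ a) (alt (toℕ (punchOut a≢b′)) x)       ≈⟨ alt-punchOut-swap a b a≢b′ b≢a′ x ⟩
    - alt (toℕ b) (alt (toℕ (punchOut b≢a′)) x)     ≈⟨ -‿cong (-‿involutive _) ⟨
    - - - alt (toℕ b) (alt (toℕ (punchOut b≢a′)) x) ≈⟨ -‿cong (-‿cong (alt-neg (toℕ b) _)) ⟨
    - - alt (toℕ b) (- alt (toℕ (punchOut b≢a′)) x) ∎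
    where
    a≢b′ : a ≢ b
    a≢b′ = a≢b ∘ ≡.cong suc
    b≢a′ : b ≢ a
    b≢a′ = b≢a ∘ ≡.cong suc

  sumFin²-antisym : ∀ n (G : Fin n → Fin n → Carrier) → (∀ a → G a a ≈ 0#) → (∀ a b → G a b + G b a ≈ 0#) →
    sumFin n (λ a → sumFin n (G a)) ≈ 0#
  sumFin²-antisym zero    G _ _ = refl
  sumFin²-antisym (suc n) G diag antisym = begin
    (G zero zero + sumFin n (G zero ∘ suc)) + sumFin n (λ a → G (suc a) zero + sumFin n (G (suc a) ∘ suc))
      ≈⟨ +-congˡ (sumFin-+ n _ _) ⟩
    (G zero zero + sumFin n (G zero ∘ suc))
      + (sumFin n (λ a → G (suc a) zero) + sumFin n (λ a → sumFin n (G (suc a) ∘ suc)))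
      ≈⟨ +-cong (+-congʳ (diag zero))
                (+-congˡ (sumFin²-antisym n (λ a b → G (suc a) (suc b)) (diag ∘ suc)
                                           (λ a b → antisym (suc a) (suc b)))) ⟩
    (0# + sumFin n (G zero ∘ suc)) + (sumFin n (λ a → G (suc a) zero) + 0#)
      ≈⟨ +-cong (+-identityˡ _) (+-identityʳ _) ⟩
    sumFin n (G zero ∘ suc) + sumFin n (λ a → G (suc a) zero)
      ≈⟨ sumFin-+ n _ _ ⟨
    sumFin n (λ b → G zero (suc b) + G (suc b) zero)
      ≈⟨ sumFin-≈0 n (antisym zero ∘ suc) ⟩
    0# ∎

  expansionTerm : ∀ {n} → Matrix (suc n) → Fin (suc n) → Carrier
  expansionTerm {n} M j = alt (toℕ j) (M zero j * det n (minor M j))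

  -- Term (a, b) of the expansion of det M along rows 0 and 1. The row-1 expansion of the a-th minor
  -- is padded with a zero at b = a, so that the double sum runs over a square.
  laplace₂ : ∀ {n} → Matrix (suc (suc n)) → Fin (suc (suc n)) → Fin (suc (suc n)) → Carrier
  laplace₂ M a b = alt (toℕ a) (M zero a * insertAt (expansionTerm (minor M a)) a 0# b)

  det-laplace₂ : ∀ n (M : Matrix (suc (suc n))) →
    det (suc (suc n)) M ≈ sumFin (suc (suc n)) (λ a → sumFin (suc (suc n)) (laplace₂ M a))
  det-laplace₂ n M = sumFin-cong (suc (suc n)) λ a → begin
    alt (toℕ a) (M zero a * det (suc n) (minor M a))
      ≈⟨ alt-cong (toℕ a) (*-congˡ (sym (sumFin-insertAt (suc n) a (expansionTerm (minor M a))))) ⟩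
    alt (toℕ a) (M zero a * sumFin (suc (suc n)) (insertAt (expansionTerm (minor M a)) a 0#))
      ≈⟨ alt-cong (toℕ a) (sumFin-*ˡ (suc (suc n)) (M zero a) (insertAt (expansionTerm (minor M a)) a 0#)) ⟩
    alt (toℕ a) (sumFin (suc (suc n)) (λ b → M zero a * insertAt (expansionTerm (minor M a)) a 0# b))
      ≈⟨ alt-sumFin (suc (suc n)) (toℕ a) (λ b → M zero a * insertAt (expansionTerm (minor M a)) a 0# b) ⟩
    sumFin (suc (suc n)) (laplace₂ M a) ∎

  laplace₂-diag : ∀ {n} (M : Matrix (suc (suc n))) a → laplace₂ M a a ≈ 0#
  laplace₂-diag M a = trans (alt-cong (toℕ a) (trans (*-congˡ (reflexive (Vecₚ.insertAt-lookup _ a 0#))) (zeroʳ _)))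
                            (alt-0# (toℕ a))

  laplace₂-offDiag : ∀ {n} (M : Matrix (suc (suc n))) a b (a≢b : a ≢ b) →
    laplace₂ M a b ≈ alt (toℕ a) (alt (toℕ (punchOut a≢b))
      (M zero a * (M (suc zero) b * det n (λ i l → M (suc (suc i)) (punchIn a (punchIn (punchOut a≢b) l))))))
  laplace₂-offDiag M a b a≢b = alt-cong (toℕ a) (begin
    M zero a * insertAt (expansionTerm (minor M a)) a 0# b
      ≈⟨ *-congˡ (reflexive insertAt-b) ⟩
    M zero a * alt (toℕ (punchOut a≢b)) (M (suc zero) (punchIn a (punchOut a≢b)) * _)
      ≈⟨ *-congˡ (alt-cong (toℕ (punchOut a≢b)) (*-congʳ (reflexive (≡.cong (M (suc zero)) (Fin.punchIn-punchOut a≢b))))) ⟩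
    M zero a * alt (toℕ (punchOut a≢b)) (M (suc zero) b * _)
      ≈⟨ alt-*ˡ (toℕ (punchOut a≢b)) _ _ ⟩
    alt (toℕ (punchOut a≢b)) (M zero a * (M (suc zero) b * _)) ∎)
    where
    insertAt-b : insertAt (expansionTerm (minor M a)) a 0# b ≡ expansionTerm (minor M a) (punchOut a≢b)
    insertAt-b = ≡.trans (≡.cong (insertAt _ a 0#) (≡.sym (Fin.punchIn-punchOut a≢b)))
                         (Vecₚ.insertAt-punchIn _ a 0# (punchOut a≢b))

  det-equalRows₀₁ : ∀ n (M : Matrix (suc (suc n))) → (∀ j → M (suc zero) j ≈ M zero j) → det (suc (suc n)) M ≈ 0#
  det-equalRows₀₁ n M M₁≈M₀ =
    trans (det-laplace₂ n M) (sumFin²-antisym (suc (suc n)) (laplace₂ M) (laplace₂-diag M) antisym)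
    where
    antisym : ∀ a b → laplace₂ M a b + laplace₂ M b a ≈ 0#
    antisym a b with a Fin.≟ b
    ... | yes ≡.refl = trans (+-cong (laplace₂-diag M a) (laplace₂-diag M a)) 0#+0#≈0#
    ... | no a≢b = begin
      laplace₂ M a b + laplace₂ M b a
        ≈⟨ +-cong (laplace₂-offDiag M a b a≢b) (laplace₂-offDiag M b a b≢a) ⟩
      alt (toℕ a) (alt (toℕ (punchOut a≢b)) X) + alt (toℕ b) (alt (toℕ (punchOut b≢a)) Y)
        ≈⟨ +-cong (alt-punchOut-swap a b a≢b b≢a X) (alt-cong (toℕ b) (alt-cong (toℕ (punchOut b≢a)) Y≈X)) ⟩
      - alt (toℕ b) (alt (toℕ (punchOut b≢a)) X) + alt (toℕ b) (alt (toℕ (punchOut b≢a)) X)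
        ≈⟨ -‿inverseˡ _ ⟩
      0# ∎
      where
      b≢a : b ≢ a
      b≢a = a≢b ∘ ≡.sym
      minor₀₁ : ∀ a b → a ≢ b → Matrix n
      minor₀₁ a b a≢b i l = M (suc (suc i)) (punchIn a (punchIn (punchOut a≢b) l))
      X Y : Carrier
      X = M zero a * (M (suc zero) b * det n (minor₀₁ a b a≢b))
      Y = M zero b * (M (suc zero) a * det n (minor₀₁ b a b≢a))
      Y≈X : Y ≈ X
      Y≈X = begin
        M zero b * (M (suc zero) a * det n (minor₀₁ b a b≢a))
          ≈⟨ *-congˡ (*-cong (M₁≈M₀ a) (det-cong n (λ i l → reflexive (≡.cong (M (suc (suc i)))
                                                       (punchIn-punchOut-swap b a b≢a a≢b l))))) ⟩
        M zero b * (M zero a * det n (minor₀₁ a b a≢b))  ≈⟨ x∙yz≈y∙xz _ _ _ ⟩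
        M zero a * (M zero b * det n (minor₀₁ a b a≢b))  ≈⟨ *-congˡ (*-congʳ (M₁≈M₀ b)) ⟨
        X ∎

  det-linear-row₀ : ∀ n (A B C : Matrix (suc n)) → (∀ j → C zero j ≈ A zero j - B zero j) →
    (∀ i j → C (suc i) j ≈ A (suc i) j) → (∀ i j → B (suc i) j ≈ A (suc i) j) →
    det (suc n) C ≈ det (suc n) A - det (suc n) B
  det-linear-row₀ n A B C C₀≈A₀-B₀ C≈A B≈A = begin
    sumFin (suc n) (expansionTerm C)
      ≈⟨ sumFin-cong (suc n) (λ j → alt-cong (toℕ j) (*-cong (C₀≈A₀-B₀ j) (det-cong n (λ i k → C≈A i (punchIn j k))))) ⟩
    sumFin (suc n) (λ j → alt (toℕ j) ((A zero j - B zero j) * det n (minor A j)))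
      ≈⟨ sumFin-cong (suc n) (λ j → trans (alt-cong (toℕ j) ([y-z]x≈yx-zx (det n (minor A j)) (A zero j) (B zero j)))
                                         (alt-sub (toℕ j) (A zero j * det n (minor A j)) (B zero j * det n (minor A j)))) ⟩
    sumFin (suc n) (λ j → expansionTerm A j - alt (toℕ j) (B zero j * det n (minor A j)))
      ≈⟨ sumFin-cong (suc n) (λ j → +-congˡ {expansionTerm A j} (-‿cong (alt-cong (toℕ j)
           (*-congˡ {B zero j} (det-cong n (λ i k → sym (B≈A i (punchIn j k)))))))) ⟩
    sumFin (suc n) (λ j → expansionTerm A j - expansionTerm B j)
      ≈⟨ sumFin-sub (suc n) (expansionTerm A) (expansionTerm B) ⟩
    det (suc n) A - det (suc n) B ∎

  det-subtractRow₀FromRow₁ : ∀ n (A C : Matrix (suc (suc n))) → (∀ j → C zero j ≈ A zero j) →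
    (∀ j → C (suc zero) j ≈ A (suc zero) j - A zero j) → (∀ i j → C (suc (suc i)) j ≈ A (suc (suc i)) j) →
    det (suc (suc n)) C ≈ det (suc (suc n)) A
  det-subtractRow₀FromRow₁ n A C C₀≈A₀ C₁≈A₁-A₀ C≈A = begin
    sumFin (suc (suc n)) (expansionTerm C)
      ≈⟨ sumFin-cong (suc (suc n)) (λ j → alt-cong (toℕ j) (*-cong (C₀≈A₀ j)
           (det-linear-row₀ n (minor A j) (minor B j) (minor C j)
              (λ k → C₁≈A₁-A₀ (punchIn j k)) (λ i k → C≈A i (punchIn j k)) (λ i k → refl)))) ⟩
    sumFin (suc (suc n)) (λ j → alt (toℕ j) (A zero j * (det (suc n) (minor A j) - det (suc n) (minor B j))))
      ≈⟨ sumFin-cong (suc (suc n)) (λ j → trans (alt-cong (toℕ j) (x[y-z]≈xy-xz (A zero j) _ _))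
                                                (alt-sub (toℕ j) (A zero j * det (suc n) (minor A j)) (A zero j * det (suc n) (minor B j)))) ⟩
    sumFin (suc (suc n)) (λ j → expansionTerm A j - expansionTerm B j)
      ≈⟨ sumFin-sub (suc (suc n)) (expansionTerm A) (expansionTerm B) ⟩
    det (suc (suc n)) A - det (suc (suc n)) B
      ≈⟨ +-congˡ (trans (-‿cong (det-equalRows₀₁ n B (λ j → refl))) -0#≈0#) ⟩
    det (suc (suc n)) A + 0#
      ≈⟨ +-identityʳ _ ⟩
    det (suc (suc n)) A ∎
    where
    B : Matrix (suc (suc n))
    B zero          = A zero
    B (suc zero)    = A zero
    B (suc (suc i)) = A (suc (suc i))

  Rows : ℕ → Set c
  Rows N = ℕ → Fin N → Carrier

  detRows : ∀ N → Rows N → Carrier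
  detRows N M = det N (λ i → M (toℕ i))

  diffRowsAfter : ∀ {N} → ℕ → Rows N → Rows N
  diffRowsAfter q M i j = if q <ᵇ i then M i j - M (pred i) j else M i j

  diffRowsAfter-minor : ∀ {N} q (M : Rows (suc N)) j r k →
    diffRowsAfter (suc q) M (suc r) (punchIn j k) ≡ diffRowsAfter q (λ r′ k′ → M (suc r′) (punchIn j k′)) r k
  diffRowsAfter-minor q M j zero    k = ≡.refl
  diffRowsAfter-minor q M j (suc r) k = ≡.refl

  det-diffRowsAfter     : ∀ n q (M : Rows (suc n)) → detRows (suc n) (diffRowsAfter q M) ≈ detRows (suc n) M
  det-diffRowsAfter-suc : ∀ n q (M : Rows (suc n)) → detRows (suc n) (diffRowsAfter (suc q) M) ≈ detRows (suc n) M

  det-diffRowsAfter zero    q       M = refl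
  det-diffRowsAfter (suc n) zero    M =
    trans (det-subtractRow₀FromRow₁ n (λ i → diffRowsAfter 1 M (toℕ i)) (λ i → diffRowsAfter 0 M (toℕ i))
                                    (λ j → refl) (λ j → refl) (λ i j → refl))
          (det-diffRowsAfter-suc (suc n) 0 M)
  det-diffRowsAfter (suc n) (suc q) M = det-diffRowsAfter-suc (suc n) q M

  det-diffRowsAfter-suc zero    q M = refl
  det-diffRowsAfter-suc (suc n) q M = sumFin-cong (suc (suc n)) λ j → alt-cong (toℕ j) (*-congˡ {M 0 j} (trans
    (det-cong (suc n) (λ i k → reflexive (diffRowsAfter-minor q M j (toℕ i) k)))
    (det-diffRowsAfter n q (λ r k → M (suc r) (punchIn j k)))))

  fwdDiff : ℕ → (ℕ → ℕ → Carrier) → ℕ → ℕ → Carrier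
  fwdDiff zero    r i j = r i j
  fwdDiff (suc k) r i j = fwdDiff k r (suc i) j - fwdDiff k r i j

  partialFwdDiff : ∀ {N} → (ℕ → ℕ → Carrier) → ℕ → Rows N
  partialFwdDiff r p i j = if i <ᵇ p then fwdDiff i r 0 (toℕ j) else fwdDiff p r (i ∸ p) (toℕ j)

  partialFwdDiff-suc : ∀ {N} r p i (j : Fin N) →
    partialFwdDiff r (suc p) i j ≈ diffRowsAfter p (partialFwdDiff r p) i j
  partialFwdDiff-suc r p i j with ℕ.<-cmp i p
  ... | tri< i<p _ _
    rewrite <⇒<ᵇ≡true (ℕ.m≤n⇒m≤1+n i<p) | ≥⇒<ᵇ≡false {p} {i} (ℕ.<⇒≤ i<p) | <⇒<ᵇ≡true i<p = refl
  ... | tri≈ _ ≡.refl _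
    rewrite <⇒<ᵇ≡true (ℕ.n<1+n i) | ≥⇒<ᵇ≡false {i} {i} ℕ.≤-refl | ℕ.n∸n≡0 i = refl
  partialFwdDiff-suc r p (suc i) j | tri> _ _ (s≤s p≤i)
    rewrite ≥⇒<ᵇ≡false {suc i} {suc p} (s≤s p≤i) | <⇒<ᵇ≡true (s≤s p≤i) | ≥⇒<ᵇ≡false {suc i} {p} (ℕ.m≤n⇒m≤1+n p≤i) =
    reflexive (≡.cong (λ z → fwdDiff p r z (toℕ j) - fwdDiff p r (i ∸ p) (toℕ j)) (≡.sym (ℕ.+-∸-assoc 1 p≤i)))

  det-partialFwdDiff : ∀ n r p → detRows (suc n) (λ i j → r i (toℕ j)) ≈ detRows (suc n) (partialFwdDiff r p)
  det-partialFwdDiff n r zero    = refl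
  det-partialFwdDiff n r (suc p) = trans (det-partialFwdDiff n r p) (sym (trans
    (det-cong (suc n) (λ i j → partialFwdDiff-suc r p (toℕ i) j))
    (det-diffRowsAfter n p (partialFwdDiff r p))))

  det-fwdDiff : ∀ n (r : ℕ → ℕ → Carrier) →
    det (suc n) (λ i j → r (toℕ i) (toℕ j)) ≈ det (suc n) (λ i j → fwdDiff (toℕ i) r 0 (toℕ j))
  det-fwdDiff n r = trans (det-partialFwdDiff n r (suc n)) (det-cong (suc n) λ i j →
    reflexive (≡.cong (λ b → if b then fwdDiff (toℕ i) r 0 (toℕ j) else fwdDiff (suc n) r (toℕ i ∸ suc n) (toℕ j))
                      (<⇒<ᵇ≡true (Fin.toℕ<n i))))

module PowerSeries {c ℓ : Level} (R : CommutativeRing c ℓ) where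
  open CommutativeRing R hiding (zero)
  open PS R
  open Sums R
  open import Relation.Binary.Reasoning.Setoid setoid

  Coefficients : Set c
  Coefficients = ℕ → Carrier

  _≋_ : Coefficients → Coefficients → Set ℓ
  f ≋ g = ∀ n → f n ≈ g n

  _⊕_ : Coefficients → Coefficients → Coefficients
  (f ⊕ g) n = f n + g n

  ⊝_ : Coefficients → Coefficients
  (⊝ f) n = - f n

  _⊛_ : Coefficients → Coefficients → Coefficients
  (f ⊛ g) n = sumTo n (λ a → f a * g (n ∸ a))

  𝟘 : Coefficients
  𝟘 n = 0#

  𝟙 : Coefficients
  𝟙 zero    = 1#
  𝟙 (suc n) = 0#

  ⊛-cong : ∀ {f f′ g g′} → f ≋ f′ → g ≋ g′ → (f ⊛ g) ≋ (f′ ⊛ g′)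
  ⊛-cong f≋f′ g≋g′ n = sumTo-cong n (λ a → *-cong (f≋f′ a) (g≋g′ (n ∸ a)))

  ⊛-comm : ∀ f g → (f ⊛ g) ≋ (g ⊛ f)
  ⊛-comm f g n = trans (sumTo-reverse n _) (sumTo-cong≤ n λ a a≤n →
    trans (*-comm _ _) (*-congʳ (reflexive (≡.cong g (ℕ.m∸[m∸n]≡n a≤n)))))

  ⊛-identityˡ : ∀ f → (𝟙 ⊛ f) ≋ f
  ⊛-identityˡ f zero    = *-identityˡ _
  ⊛-identityˡ f (suc n) =
    trans (sumTo-suc n _) (trans (+-cong (*-identityˡ _) (sumTo-≈0 n (λ k _ → zeroˡ _))) (+-identityʳ _))

  ⊛-distribˡ : ∀ f g h → (f ⊛ (g ⊕ h)) ≋ ((f ⊛ g) ⊕ (f ⊛ h))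
  ⊛-distribˡ f g h n = trans (sumTo-cong n (λ a → distribˡ _ _ _)) (sumTo-+ n _ _)

  ⊛-assoc : ∀ f g h → ((f ⊛ g) ⊛ h) ≋ (f ⊛ (g ⊛ h))
  ⊛-assoc f g h n = begin
    sumTo n (λ s → sumTo s (λ a → f a * g (s ∸ a)) * h (n ∸ s))
      ≈⟨ sumTo-cong n (λ s → sumTo-*ʳ s _ _) ⟩
    sumTo n (λ s → sumTo s (λ a → (f a * g (s ∸ a)) * h (n ∸ s)))
      ≈⟨ sumTo-cong n (λ s → sumTo-cong≤ s λ a a≤s →
           trans (*-assoc _ _ _) (*-congˡ (*-congˡ (reflexive (≡.cong h (≡.sym (∸-∸ a≤s))))))) ⟩
    sumTo n (λ s → sumTo s (λ a → f a * (g (s ∸ a) * h (n ∸ a ∸ (s ∸ a)))))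
      ≈⟨ sumTo-triangle n (λ a b → f a * (g b * h (n ∸ a ∸ b))) ⟨
    sumTo n (λ a → sumTo (n ∸ a) (λ b → f a * (g b * h (n ∸ a ∸ b))))
      ≈⟨ sumTo-cong n (λ a → sym (sumTo-*ˡ (n ∸ a) _ _)) ⟩
    sumTo n (λ a → f a * sumTo (n ∸ a) (λ b → g b * h (n ∸ a ∸ b))) ∎
    where
    ∸-∸ : ∀ {a s} → a ≤ℕ s → n ∸ a ∸ (s ∸ a) ≡ n ∸ s
    ∸-∸ {a} {s} a≤s = ≡.trans (ℕ.∸-+-assoc n a (s ∸ a)) (≡.cong (n ∸_) (ℕ.m+[n∸m]≡n a≤s))

  ⊛-isCommutativeRing : IsCommutativeRing _≋_ _⊕_ _⊛_ ⊝_ 𝟘 𝟙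
  ⊛-isCommutativeRing = record
    { isRing = record
      { +-isAbelianGroup = record
        { isGroup = record
          { isMonoid = record
            { isSemigroup = record
              { isMagma = record
                { isEquivalence = record
                  { refl = λ n → refl ; sym = λ e n → sym (e n) ; trans = λ e e′ n → trans (e n) (e′ n) }
                ; ∙-cong = λ e e′ n → +-cong (e n) (e′ n) }
              ; assoc = λ f g h n → +-assoc _ _ _ }
            ; identity = (λ f n → +-identityˡ _) , (λ f n → +-identityʳ _) }
          ; inverse = (λ f n → -‿inverseˡ _) , (λ f n → -‿inverseʳ _)
          ; ⁻¹-cong = λ e n → -‿cong (e n) }
        ; comm = λ f g n → +-comm _ _ }
      ; *-cong = ⊛-cong
      ; *-assoc = ⊛-assoc
      ; *-identity = ⊛-identityˡ , (λ f n → trans (⊛-comm f 𝟙 n) (⊛-identityˡ f n))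
      ; distrib = ⊛-distribˡ , λ f g h n →
          trans (⊛-comm (g ⊕ h) f n) (trans (⊛-distribˡ f g h n) (+-cong (⊛-comm f g n) (⊛-comm f h n)))
      }
    ; *-comm = ⊛-comm
    }

  powerSeriesRing : CommutativeRing c ℓ
  powerSeriesRing = record { isCommutativeRing = ⊛-isCommutativeRing }

  sumTo-pointwise : ∀ m (G : ℕ → Coefficients) n → PS.sumTo powerSeriesRing m G n ≡ sumTo m (λ a → G a n)
  sumTo-pointwise zero    G n = ≡.refl
  sumTo-pointwise (suc m) G n = ≡.cong (_+ G (suc m) n) (sumTo-pointwise m G n)

module Composition {c ℓ : Level} (R : CommutativeRing c ℓ) where
  open CommutativeRing R hiding (zero)
  open PS R
  open Sums R
  open import Relation.Binary.Reasoning.Setoid setoid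

  -- Series is the carrier of R[[x]][[t]], whose product agrees with mulS (mulS≡*ₛ).
  SeriesRing : CommutativeRing c ℓ
  SeriesRing = PowerSeries.powerSeriesRing (PowerSeries.powerSeriesRing R)

  module S = CommutativeRing SeriesRing
  open S using () renaming (_≈_ to _≈ₛ_; _*_ to _*ₛ_)
  open import Algebra.Properties.Semiring.Exp S.semiring using (^-homo-*) renaming (_^_ to _^ₛ_)
  open import Algebra.Properties.CommutativeSemigroup S.*-commutativeSemigroup
    using () renaming (interchange to *ₛ-interchange)

  sumToₛ : ℕ → (ℕ → Series) → Series
  sumToₛ = PS.sumTo SeriesRing

  sumToₛ-pointwise : ∀ m (G : ℕ → Series) k n → sumToₛ m G k n ≡ sumTo m (λ a → G a k n)
  sumToₛ-pointwise m G k n =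
    ≡.trans (≡.cong (λ h → h n) (PowerSeries.sumTo-pointwise (PowerSeries.powerSeriesRing R) m G k))
                                      (PowerSeries.sumTo-pointwise R m (λ a → G a k) n)

  sumToₛ²-pointwise : ∀ M N (G : ℕ → ℕ → Series) m n →
    sumToₛ M (λ a → sumToₛ N (G a)) m n ≈ sumTo M (λ a → sumTo N (λ b → G a b m n))
  sumToₛ²-pointwise M N G m n =
    trans (reflexive (sumToₛ-pointwise M _ m n)) (sumTo-cong M (λ a → reflexive (sumToₛ-pointwise N (G a) m n)))

  mulS≡*ₛ : ∀ p q m n → mulS p q m n ≡ (p *ₛ q) m n
  mulS≡*ₛ p q m n = ≡.sym (PowerSeries.sumTo-pointwise R m (λ a → PowerSeries._⊛_ R (p a) (q (m ∸ a))) n)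

  powS≈^ : ∀ g k m n → powS g k m n ≈ (g ^ₛ k) m n
  powS≈^ g zero    zero    zero    = refl
  powS≈^ g zero    zero    (suc n) = refl
  powS≈^ g zero    (suc m) n       = refl
  powS≈^ g (suc k) m n = trans (reflexive (mulS≡*ₛ g (powS g k) m n)) (S.*-congˡ {g} (powS≈^ g k) m n)

  monomial : Carrier → ℕ → ℕ → Series
  monomial a k l m n = δ m k (δ n l a)

  monomial-cong : ∀ {a b} k l → a ≈ b → monomial a k l ≈ₛ monomial b k l
  monomial-cong k l a≈b m n = δ-cong m k (δ-cong n l a≈b)

  monomial-*ₛ : ∀ a k l w m n → k ≤ℕ m → l ≤ℕ n → (monomial a k l *ₛ w) m n ≈ a * w (m ∸ k) (n ∸ l)
  monomial-*ₛ a k l w m n k≤m l≤n = trans (reflexive (≡.sym (mulS≡*ₛ (monomial a k l) w m n)))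
                                          (sumTo²-δ m n k l a (λ k′ l′ → w (m ∸ k′) (n ∸ l′)) k≤m l≤n)

  monomial-*ₛ-beyond₁ : ∀ a k l w m n → m <ℕ k → (monomial a k l *ₛ w) m n ≈ 0#
  monomial-*ₛ-beyond₁ a k l w m n m<k = trans (reflexive (≡.sym (mulS≡*ₛ (monomial a k l) w m n)))
                                              (sumTo²-δ-beyond₁ m n k l a (λ k′ l′ → w (m ∸ k′) (n ∸ l′)) m<k)

  monomial-*ₛ-beyond₂ : ∀ a k l w m n → n <ℕ l → (monomial a k l *ₛ w) m n ≈ 0#
  monomial-*ₛ-beyond₂ a k l w m n n<l = trans (reflexive (≡.sym (mulS≡*ₛ (monomial a k l) w m n)))
                                              (sumTo²-δ-beyond₂ m n k l a (λ k′ l′ → w (m ∸ k′) (n ∸ l′)) n<l)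

  monomial-*ₛ-monomial : ∀ a k l b k′ l′ → monomial a k l *ₛ monomial b k′ l′ ≈ₛ monomial (a * b) (k +ℕ k′) (l +ℕ l′)
  monomial-*ₛ-monomial a k l b k′ l′ m n with k ℕ.≤? m | l ℕ.≤? n
  ... | yes k≤m | yes l≤n = begin
    (monomial a k l *ₛ monomial b k′ l′) m n  ≈⟨ monomial-*ₛ a k l (monomial b k′ l′) m n k≤m l≤n ⟩
    a * δ (m ∸ k) k′ (δ (n ∸ l) l′ b)
      ≈⟨ *-congˡ (reflexive (≡.trans (δ-⇔ (m ∸ k) k′ m (k +ℕ k′) _ (shift k≤m) (unshift k))
                                     (≡.cong (δ m (k +ℕ k′)) (δ-⇔ (n ∸ l) l′ n (l +ℕ l′) _ (shift l≤n) (unshift l))))) ⟩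
    a * δ m (k +ℕ k′) (δ n (l +ℕ l′) b)      ≈⟨ trans (δ-*ˡ m _ a _) (δ-cong m _ (δ-*ˡ n _ a b)) ⟩
    monomial (a * b) (k +ℕ k′) (l +ℕ l′) m n ∎
    where
    shift : ∀ {p q r} → p ≤ℕ q → q ∸ p ≡ r → q ≡ p +ℕ r
    shift p≤q ≡.refl = ≡.sym (ℕ.m+[n∸m]≡n p≤q)
    unshift : ∀ p {q r} → q ≡ p +ℕ r → q ∸ p ≡ r
    unshift p ≡.refl = ℕ.m+n∸m≡n p _
  ... | _ | no l≰n = trans (monomial-*ₛ-beyond₂ a k l (monomial b k′ l′) m n (ℕ.≰⇒> l≰n)) (sym (trans
    (δ-cong m _ (reflexive (δ-≢ n _ _ (λ n≡ → l≰n (≡.subst (l ≤ℕ_) (≡.sym n≡) (ℕ.m≤m+n l l′))))))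
    (δ-0# m _)))
  ... | no k≰m | yes _ = trans (monomial-*ₛ-beyond₁ a k l (monomial b k′ l′) m n (ℕ.≰⇒> k≰m))
    (sym (reflexive (δ-≢ m _ _ (λ m≡ → k≰m (≡.subst (k ≤ℕ_) (≡.sym m≡) (ℕ.m≤m+n k k′))))))

  1ₛ≈monomial : S.1# ≈ₛ monomial 1# 0 0
  1ₛ≈monomial zero    zero    = refl
  1ₛ≈monomial zero    (suc n) = refl
  1ₛ≈monomial (suc m) n       = refl

  tS≈monomial : tS ≈ₛ monomial 1# 1 0
  tS≈monomial zero                n       = refl
  tS≈monomial (suc zero)          zero    = refl
  tS≈monomial (suc zero)          (suc n) = refl
  tS≈monomial (suc (suc m))       zero    = refl
  tS≈monomial (suc (suc m))       (suc n) = refl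

  tS^ₛ≈monomial : ∀ a → tS ^ₛ a ≈ₛ monomial 1# a 0
  tS^ₛ≈monomial zero    = 1ₛ≈monomial
  tS^ₛ≈monomial (suc a) = S.trans (S.*-cong tS≈monomial (tS^ₛ≈monomial a))
    (S.trans (monomial-*ₛ-monomial 1# 1 0 1# a 0) (monomial-cong (suc a) 0 (*-identityˡ 1#)))

  NoTFreeTerm : Series → Set ℓ
  NoTFreeTerm g = ∀ n → g 0 n ≈ 0#

  NoTFreeTerm-tS : NoTFreeTerm tS
  NoTFreeTerm-tS n = refl

  NoTFreeTerm-fS : ∀ b → NoTFreeTerm (fS b)
  NoTFreeTerm-fS b n = refl

  powS-lowOrder : ∀ g → NoTFreeTerm g → ∀ k m n → m <ℕ k → powS g k m n ≈ 0#
  powS-lowOrder g g₀≈0 (suc k) m n m<k = sumTo-≈0 m term≈0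
    where
    term≈0 : ∀ a → a ≤ℕ m → sumTo n (λ e → g a e * powS g k (m ∸ a) (n ∸ e)) ≈ 0#
    term≈0 zero    _    = sumTo-≈0 n (λ e _ → trans (*-congʳ (g₀≈0 e)) (zeroˡ _))
    term≈0 (suc a) a<m = sumTo-≈0 n λ e _ → trans
      (*-congˡ (powS-lowOrder g g₀≈0 k (m ∸ suc a) (n ∸ e)
                  (ℕ.<-≤-trans (ℕ.∸-monoʳ-< {m} {suc a} {0} (s≤s z≤n) a<m) (ℕ.≤-pred m<k))))
      (zeroʳ _)

  ^ₛ-lowOrder : ∀ g → NoTFreeTerm g → ∀ k m n → m <ℕ k → (g ^ₛ k) m n ≈ 0#
  ^ₛ-lowOrder g g₀≈0 k m n m<k = trans (sym (powS≈^ g k m n)) (powS-lowOrder g g₀≈0 k m n m<k)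

  compS-cong≤ : ∀ {u u′} h m n → (∀ k l → k ≤ℕ m → l ≤ℕ n → u k l ≈ u′ k l) → compS u h m n ≈ compS u′ h m n
  compS-cong≤ h m n u≈u′ = sumTo-cong≤ m (λ k k≤m → sumTo-cong≤ n (λ l l≤n → *-congʳ (u≈u′ k l k≤m l≤n)))

  compS-congˡ : ∀ {u u′} h → u ≈ₛ u′ → ∀ m n → compS u h m n ≈ compS u′ h m n
  compS-congˡ h u≈u′ m n = compS-cong≤ h m n (λ k l _ _ → u≈u′ k l)

  compS-+ : ∀ u v h m n → compS (u S.+ v) h m n ≈ compS u h m n + compS v h m n
  compS-+ u v h m n =
    trans (sumTo-cong m (λ k → trans (sumTo-cong n (λ l → distribʳ _ _ _)) (sumTo-+ n _ _))) (sumTo-+ m _ _)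

  compS-sub : ∀ u v h m n → compS (u S.- v) h m n ≈ compS u h m n - compS v h m n
  compS-sub u v h m n =
    trans (sumTo-cong m (λ k → trans (sumTo-cong n (λ l → [y-z]x≈yx-zx _ _ _)) (sumTo-sub n _ _))) (sumTo-sub m _ _)
    where open import Algebra.Properties.Ring ring using ([y-z]x≈yx-zx)

  compS-sumToₛ : ∀ K (G : ℕ → Series) h m n → compS (sumToₛ K G) h m n ≈ sumTo K (λ i → compS (G i) h m n)
  compS-sumToₛ zero    G h m n = refl
  compS-sumToₛ (suc K) G h m n = trans (compS-+ (sumToₛ K G) (G (suc K)) h m n) (+-congʳ (compS-sumToₛ K G h m n))

  compS-sumToₛ² : ∀ M N (G : ℕ → ℕ → Series) h m n →
    compS (sumToₛ M (λ a → sumToₛ N (G a))) h m n ≈ sumTo M (λ a → sumTo N (λ b → compS (G a b) h m n))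
  compS-sumToₛ² M N G h m n = trans (compS-sumToₛ M _ h m n) (sumTo-cong M (λ a → compS-sumToₛ N (G a) h m n))

  compS-monomial : ∀ h → NoTFreeTerm h → ∀ a k l → compS (monomial a k l) h ≈ₛ monomial a 0 l *ₛ (h ^ₛ k)
  compS-monomial h h₀≈0 a k l m n with k ℕ.≤? m | l ℕ.≤? n
  ... | yes k≤m | yes l≤n = trans (sumTo²-δ m n k l a (λ k′ l′ → powS h k′ m (n ∸ l′)) k≤m l≤n) (sym (trans
    (monomial-*ₛ a 0 l (h ^ₛ k) m n z≤n l≤n) (*-congˡ (sym (powS≈^ h k m (n ∸ l))))))
  ... | _       | no l≰n  = trans (sumTo²-δ-beyond₂ m n k l a (λ k′ l′ → powS h k′ m (n ∸ l′)) (ℕ.≰⇒> l≰n))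
    (sym (monomial-*ₛ-beyond₂ a 0 l (h ^ₛ k) m n (ℕ.≰⇒> l≰n)))
  ... | no k≰m  | yes l≤n = trans (sumTo²-δ-beyond₁ m n k l a (λ k′ l′ → powS h k′ m (n ∸ l′)) (ℕ.≰⇒> k≰m)) (sym (trans
    (monomial-*ₛ a 0 l (h ^ₛ k) m n z≤n l≤n)
    (trans (*-congˡ (^ₛ-lowOrder h h₀≈0 k m (n ∸ l) (ℕ.≰⇒> k≰m))) (zeroʳ _))))

  -- In degrees ≤ (M, N), u ∘ h agrees with the polynomial Σ u_{kl} xˡ hᵏ (compS≈compExpansion),
  -- through which composition inherits the ring laws.
  compExpansion : Series → Series → ℕ → ℕ → Series
  compExpansion u h M N = sumToₛ M (λ k → sumToₛ N (λ l → monomial (u k l) 0 l *ₛ (h ^ₛ k)))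

  compS≈compExpansion : ∀ u h → NoTFreeTerm h → ∀ M N m n → m ≤ℕ M → n ≤ℕ N →
    compS u h m n ≈ compExpansion u h M N m n
  compS≈compExpansion u h h₀≈0 M N m n m≤M n≤N = sym (begin
    compExpansion u h M N m n
      ≈⟨ sumToₛ²-pointwise M N _ m n ⟩
    sumTo M (λ k → sumTo N (λ l → (monomial (u k l) 0 l *ₛ (h ^ₛ k)) m n))
      ≈⟨ sumTo-cong M (λ k → sumTo-extend n N n≤N (λ l n<l _ → monomial-*ₛ-beyond₂ (u k l) 0 l (h ^ₛ k) m n n<l)) ⟩
    sumTo M (λ k → sumTo n (λ l → (monomial (u k l) 0 l *ₛ (h ^ₛ k)) m n))
      ≈⟨ sumTo-cong M (λ k → sumTo-cong≤ n (λ l l≤n → monomial-*ₛ (u k l) 0 l (h ^ₛ k) m n z≤n l≤n)) ⟩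
    sumTo M (λ k → sumTo n (λ l → u k l * (h ^ₛ k) m (n ∸ l)))
      ≈⟨ sumTo-extend m M m≤M (λ k m<k _ → sumTo-≈0 n (λ l _ →
           trans (*-congˡ (^ₛ-lowOrder h h₀≈0 k m (n ∸ l) m<k)) (zeroʳ _))) ⟩
    sumTo m (λ k → sumTo n (λ l → u k l * (h ^ₛ k) m (n ∸ l)))
      ≈⟨ sumTo-cong m (λ k → sumTo-cong n (λ l → *-congˡ (sym (powS≈^ h k m (n ∸ l))))) ⟩
    compS u h m n ∎)

  truncation : Series → ℕ → ℕ → Series
  truncation u M N = sumToₛ M (λ a → sumToₛ N (λ b → monomial (u a b) a b))

  truncation-coeff : ∀ u M N m n → m ≤ℕ M → n ≤ℕ N → truncation u M N m n ≈ u m n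
  truncation-coeff u M N m n m≤M n≤N = begin
    truncation u M N m n
      ≈⟨ sumToₛ²-pointwise M N _ m n ⟩
    sumTo M (λ a → sumTo N (λ b → δ m a (δ n b (u a b))))
      ≈⟨ sumTo-cong M (λ a → sumTo-cong N (λ b → reflexive (≡.trans (δ-sym m a _) (≡.cong (δ a m) (δ-sym n b _))))) ⟩
    sumTo M (λ a → sumTo N (λ b → δ a m (δ b n (u a b))))
      ≈⟨ sumTo-cong M (λ a → sumTo-δ-comm N a m _) ⟩
    sumTo M (λ a → δ a m (sumTo N (λ b → δ b n (u a b))))
      ≈⟨ sumTo-δ M m _ m≤M ⟩
    sumTo N (λ b → δ b n (u m b))
      ≈⟨ sumTo-δ N n _ n≤N ⟩
    u m n ∎

  *ₛ-cong≤ : ∀ {u u′ v v′} M N → (∀ k l → k ≤ℕ M → l ≤ℕ N → u k l ≈ u′ k l) →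
    (∀ k l → k ≤ℕ M → l ≤ℕ N → v k l ≈ v′ k l) → ∀ m n → m ≤ℕ M → n ≤ℕ N → (u *ₛ v) m n ≈ (u′ *ₛ v′) m n
  *ₛ-cong≤ {u} {u′} {v} {v′} M N u≈u′ v≈v′ m n m≤M n≤N = begin
    (u *ₛ v) m n    ≡⟨ mulS≡*ₛ u v m n ⟨
    mulS u v m n
      ≈⟨ sumTo-cong≤ m (λ a a≤m → sumTo-cong≤ n λ e e≤n →
           *-cong (u≈u′ a e (ℕ.≤-trans a≤m m≤M) (ℕ.≤-trans e≤n n≤N))
                  (v≈v′ (m ∸ a) (n ∸ e) (ℕ.≤-trans (ℕ.m∸n≤m m a) m≤M) (ℕ.≤-trans (ℕ.m∸n≤m n e) n≤N))) ⟩
    mulS u′ v′ m n  ≡⟨ mulS≡*ₛ u′ v′ m n ⟩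
    (u′ *ₛ v′) m n  ∎

  compS-monomial-*ₛ-monomial : ∀ h → NoTFreeTerm h → ∀ a k l b k′ l′ →
    compS (monomial a k l *ₛ monomial b k′ l′) h ≈ₛ (monomial a 0 l *ₛ (h ^ₛ k)) *ₛ (monomial b 0 l′ *ₛ (h ^ₛ k′))
  compS-monomial-*ₛ-monomial h h₀≈0 a k l b k′ l′ m n = begin
    compS (monomial a k l *ₛ monomial b k′ l′) h m n
      ≈⟨ compS-congˡ h (monomial-*ₛ-monomial a k l b k′ l′) m n ⟩
    compS (monomial (a * b) (k +ℕ k′) (l +ℕ l′)) h m n
      ≈⟨ compS-monomial h h₀≈0 (a * b) (k +ℕ k′) (l +ℕ l′) m n ⟩
    (monomial (a * b) 0 (l +ℕ l′) *ₛ (h ^ₛ (k +ℕ k′))) m n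
      ≈⟨ S.*-cong (S.sym (monomial-*ₛ-monomial a 0 l b 0 l′)) (^-homo-* h k k′) m n ⟩
    ((monomial a 0 l *ₛ monomial b 0 l′) *ₛ ((h ^ₛ k) *ₛ (h ^ₛ k′))) m n
      ≈⟨ *ₛ-interchange (monomial a 0 l) (monomial b 0 l′) (h ^ₛ k) (h ^ₛ k′) m n ⟩
    ((monomial a 0 l *ₛ (h ^ₛ k)) *ₛ (monomial b 0 l′ *ₛ (h ^ₛ k′))) m n ∎

  compS-*ₛ-truncation : ∀ h → NoTFreeTerm h → ∀ u v m n →
    compS (truncation u m n *ₛ truncation v m n) h m n ≈ (compExpansion u h m n *ₛ compExpansion v h m n) m n
  compS-*ₛ-truncation h h₀≈0 u v m n = begin
    compS (truncation u m n *ₛ truncation v m n) h m n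
      ≈⟨ compS-congˡ h (Sumsₛ.sumTo²-* m n m n U V) m n ⟩
    compS (sumToₛ m (λ a → sumToₛ n (λ b → sumToₛ m (λ a′ → sumToₛ n (λ b′ → U a b *ₛ V a′ b′))))) h m n
      ≈⟨ compS-sumToₛ² m n _ h m n ⟩
    sumTo m (λ a → sumTo n (λ b → compS (sumToₛ m (λ a′ → sumToₛ n (λ b′ → U a b *ₛ V a′ b′))) h m n))
      ≈⟨ sumTo-cong m (λ a → sumTo-cong n (λ b → compS-sumToₛ² m n _ h m n)) ⟩
    sumTo m (λ a → sumTo n (λ b → sumTo m (λ a′ → sumTo n (λ b′ → compS (U a b *ₛ V a′ b′) h m n))))
      ≈⟨ sumTo-cong m (λ a → sumTo-cong n (λ b → sumTo-cong m (λ a′ → sumTo-cong n (λ b′ →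
           compS-monomial-*ₛ-monomial h h₀≈0 (u a b) a b (v a′ b′) a′ b′ m n)))) ⟩
    sumTo m (λ a → sumTo n (λ b → sumTo m (λ a′ → sumTo n (λ b′ → (U∘h a b *ₛ V∘h a′ b′) m n))))
      ≈⟨ sumTo-cong m (λ a → sumTo-cong n (λ b → sumToₛ²-pointwise m n _ m n)) ⟨
    sumTo m (λ a → sumTo n (λ b → sumToₛ m (λ a′ → sumToₛ n (λ b′ → U∘h a b *ₛ V∘h a′ b′)) m n))
      ≈⟨ sumToₛ²-pointwise m n _ m n ⟨
    sumToₛ m (λ a → sumToₛ n (λ b → sumToₛ m (λ a′ → sumToₛ n (λ b′ → U∘h a b *ₛ V∘h a′ b′)))) m n
      ≈⟨ Sumsₛ.sumTo²-* m n m n U∘h V∘h m n ⟨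
    (compExpansion u h m n *ₛ compExpansion v h m n) m n ∎
    where
    module Sumsₛ = Sums SeriesRing
    U V U∘h V∘h : ℕ → ℕ → Series
    U a b = monomial (u a b) a b
    V a b = monomial (v a b) a b
    U∘h a b = monomial (u a b) 0 b *ₛ (h ^ₛ a)
    V∘h a b = monomial (v a b) 0 b *ₛ (h ^ₛ a)

  compS-*ₛ : ∀ h → NoTFreeTerm h → ∀ u v → compS (u *ₛ v) h ≈ₛ compS u h *ₛ compS v h
  compS-*ₛ h h₀≈0 u v m n = begin
    compS (u *ₛ v) h m n
      ≈⟨ compS-cong≤ h m n (*ₛ-cong≤ m n (λ k l k≤m l≤n → sym (truncation-coeff u m n k l k≤m l≤n))
                                         (λ k l k≤m l≤n → sym (truncation-coeff v m n k l k≤m l≤n))) ⟩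
    compS (truncation u m n *ₛ truncation v m n) h m n
      ≈⟨ compS-*ₛ-truncation h h₀≈0 u v m n ⟩
    (compExpansion u h m n *ₛ compExpansion v h m n) m n
      ≈⟨ *ₛ-cong≤ m n (λ k l k≤m l≤n → sym (compS≈compExpansion u h h₀≈0 m n k l k≤m l≤n))
                      (λ k l k≤m l≤n → sym (compS≈compExpansion v h h₀≈0 m n k l k≤m l≤n)) m n ℕ.≤-refl ℕ.≤-refl ⟩
    (compS u h *ₛ compS v h) m n ∎

  compS-1ₛ : ∀ h → NoTFreeTerm h → compS S.1# h ≈ₛ S.1#
  compS-1ₛ h h₀≈0 m n = begin
    compS S.1# h m n                        ≈⟨ compS-congˡ h 1ₛ≈monomial m n ⟩
    compS (monomial 1# 0 0) h m n           ≈⟨ compS-monomial h h₀≈0 1# 0 0 m n ⟩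
    (monomial 1# 0 0 *ₛ S.1#) m n           ≈⟨ S.*-identityʳ (monomial 1# 0 0) m n ⟩
    monomial 1# 0 0 m n                     ≈⟨ 1ₛ≈monomial m n ⟨
    S.1# m n                                ∎

  compS-^ₛ : ∀ h → NoTFreeTerm h → ∀ g k → compS (g ^ₛ k) h ≈ₛ compS g h ^ₛ k
  compS-^ₛ h h₀≈0 g zero    = compS-1ₛ h h₀≈0
  compS-^ₛ h h₀≈0 g (suc k) = S.trans (compS-*ₛ h h₀≈0 g (g ^ₛ k)) (S.*-congˡ {compS g h} (compS-^ₛ h h₀≈0 g k))

  NoTFreeTerm-compS : ∀ g h → NoTFreeTerm g → NoTFreeTerm (compS g h)
  NoTFreeTerm-compS g h g₀≈0 n = sumTo-≈0 n (λ l _ → trans (*-congʳ (g₀≈0 l)) (zeroˡ _))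

  compS-assoc : ∀ φ g h → NoTFreeTerm g → NoTFreeTerm h → compS (compS φ g) h ≈ₛ compS φ (compS g h)
  compS-assoc φ g h g₀≈0 h₀≈0 m n = begin
    compS (compS φ g) h m n
      ≈⟨ compS-cong≤ h m n (λ k l k≤m l≤n → compS≈compExpansion φ g g₀≈0 m n k l k≤m l≤n) ⟩
    compS (compExpansion φ g m n) h m n
      ≈⟨ compS-sumToₛ² m n _ h m n ⟩
    sumTo m (λ a → sumTo n (λ b → compS (monomial (φ a b) 0 b *ₛ (g ^ₛ a)) h m n))
      ≈⟨ sumTo-cong m (λ a → sumTo-cong n (λ b → trans (compS-*ₛ h h₀≈0 _ _ m n)
           (S.*-cong (λ m′ n′ → trans (compS-monomial h h₀≈0 (φ a b) 0 b m′ n′)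
                                      (S.*-identityʳ (monomial (φ a b) 0 b) m′ n′))
                     (compS-^ₛ h h₀≈0 g a) m n))) ⟩
    sumTo m (λ a → sumTo n (λ b → (monomial (φ a b) 0 b *ₛ (compS g h ^ₛ a)) m n))
      ≈⟨ sumToₛ²-pointwise m n _ m n ⟨
    compExpansion φ (compS g h) m n m n
      ≈⟨ compS≈compExpansion φ (compS g h) (NoTFreeTerm-compS g h g₀≈0) m n m n ℕ.≤-refl ℕ.≤-refl ⟨
    compS φ (compS g h) m n ∎

  compS-identityˡ : ∀ g → NoTFreeTerm g → compS tS g ≈ₛ g
  compS-identityˡ g g₀≈0 m n = begin
    compS tS g m n                    ≈⟨ compS-congˡ g tS≈monomial m n ⟩
    compS (monomial 1# 1 0) g m n     ≈⟨ compS-monomial g g₀≈0 1# 1 0 m n ⟩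
    (monomial 1# 0 0 *ₛ (g *ₛ S.1#)) m n ≈⟨ S.*-cong (S.sym 1ₛ≈monomial) (S.*-identityʳ g) m n ⟩
    (S.1# *ₛ g) m n                   ≈⟨ S.*-identityˡ g m n ⟩
    g m n                             ∎

  compS-identityʳ : ∀ φ → compS φ tS ≈ₛ φ
  compS-identityʳ φ m n = begin
    compS φ tS m n
      ≈⟨ compS≈compExpansion φ tS NoTFreeTerm-tS m n m n ℕ.≤-refl ℕ.≤-refl ⟩
    compExpansion φ tS m n m n
      ≈⟨ sumToₛ²-pointwise m n _ m n ⟩
    sumTo m (λ a → sumTo n (λ b → (monomial (φ a b) 0 b *ₛ (tS ^ₛ a)) m n))
      ≈⟨ sumTo-cong m (λ a → sumTo-cong n (λ b → S.trans (S.*-congˡ {monomial (φ a b) 0 b} (tS^ₛ≈monomial a))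
           (S.trans (monomial-*ₛ-monomial (φ a b) 0 b 1# a 0) (monomial-cong a (b +ℕ 0) (*-identityʳ (φ a b)))) m n)) ⟩
    sumTo m (λ a → sumTo n (λ b → monomial (φ a b) a (b +ℕ 0) m n))
      ≈⟨ sumTo-cong m (λ a → sumTo-cong n (λ b → reflexive (≡.cong (λ e → monomial (φ a b) a e m n) (ℕ.+-identityʳ b)))) ⟩
    sumTo m (λ a → sumTo n (λ b → monomial (φ a b) a b m n))
      ≈⟨ sumToₛ²-pointwise m n _ m n ⟨
    truncation φ m n m n
      ≈⟨ truncation-coeff φ m n m n ℕ.≤-refl ℕ.≤-refl ⟩
    φ m n ∎

  diagCoeff-cong : ∀ {u v} j → u ≈ₛ v → diagCoeff u j ≈ diagCoeff v j
  diagCoeff-cong j u≈v = sumTo-cong j (λ m → u≈v m (j ∸ m))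

  diagCoeff-sub : ∀ u v j → diagCoeff (u S.- v) j ≈ diagCoeff u j - diagCoeff v j
  diagCoeff-sub u v j = sumTo-sub j _ _

module Iterates {c ℓ : Level} (R : CommutativeRing c ℓ) (b : ℕ → ℕ → CommutativeRing.Carrier R)
                (b₁₀≈1 : CommutativeRing._≈_ R (b 1 0) (CommutativeRing.1# R)) where
  open CommutativeRing R hiding (zero)
  open PS R
  open Sums R
  open Composition R
  open import Relation.Binary.Reasoning.Setoid setoid
  open import Algebra.Properties.Semiring.Mult semiring using (×-homo-+; ×1-homo-*) renaming (_×_ to _×ᵣ_)

  fromℕ≡×1# : ∀ k → fromℕ k ≡ k ×ᵣ 1#
  fromℕ≡×1# zero    = ≡.refl
  fromℕ≡×1# (suc k) = ≡.cong (1# +_) (fromℕ≡×1# k)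

  fromℕ-+ : ∀ p q → fromℕ (p +ℕ q) ≈ fromℕ p + fromℕ q
  fromℕ-+ p q rewrite fromℕ≡×1# (p +ℕ q) | fromℕ≡×1# p | fromℕ≡×1# q = ×-homo-+ 1# p q

  fromℕ-* : ∀ p q → fromℕ (p *ℕ q) ≈ fromℕ p * fromℕ q
  fromℕ-* p q rewrite fromℕ≡×1# (p *ℕ q) | fromℕ≡×1# p | fromℕ≡×1# q = ×1-homo-* p q

  fromℕ-suc-* : ∀ k x → fromℕ k * x + x ≈ fromℕ (suc k) * x
  fromℕ-suc-* k x = trans (+-comm _ _) (trans (+-congʳ (sym (*-identityˡ x))) (sym (distribʳ x 1# (fromℕ k))))

  f : Series
  f = fS b

  f*powS-f-lowOrder : ∀ k m e n j a → m ≤ℕ k +ℕ j → j <ℕ a → a ≤ℕ m → f a e * powS f k (m ∸ a) n ≈ 0#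
  f*powS-f-lowOrder k m e n j a m≤k+j j<a a≤m =
    trans (*-congˡ (powS-lowOrder f (NoTFreeTerm-fS b) k (m ∸ a) n (∸-<-bound m≤k+j j<a a≤m))) (zeroʳ _)

  powS-f-tᵏ : ∀ k → powS f k k 0 ≈ 1#
  powS-f-tᵏ zero    = refl
  powS-f-tᵏ (suc k) = begin
    sumTo (suc k) (λ a → f a 0 * powS f k (suc k ∸ a) 0)  ≈⟨ sumTo-single (suc k) 1 (s≤s z≤n) others≈0 ⟩
    b 1 0 * powS f k k 0                                  ≈⟨ *-cong b₁₀≈1 (powS-f-tᵏ k) ⟩
    1# * 1#                                               ≈⟨ *-identityˡ _ ⟩
    1#                                                    ∎
    where
    others≈0 : ∀ a → a ≤ℕ suc k → a ≢ 1 → f a 0 * powS f k (suc k ∸ a) 0 ≈ 0#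
    others≈0 zero          _   _   = zeroˡ _
    others≈0 (suc zero)    _   a≢1 = ⊥-elim (a≢1 ≡.refl)
    others≈0 (suc (suc a)) a≤m _   =
      f*powS-f-lowOrder k (suc k) 0 0 1 (suc (suc a)) (ℕ.≤-reflexive (ℕ.+-comm 1 k)) (s≤s (s≤s z≤n)) a≤m

  powS-f-tᵏx : ∀ k → powS f k k 1 ≈ fromℕ k * b 1 1
  powS-f-tᵏx zero    = sym (zeroˡ _)
  powS-f-tᵏx (suc k) = begin
    sumTo (suc k) (λ a → f a 0 * powS f k (suc k ∸ a) 1 + f a 1 * powS f k (suc k ∸ a) 0)
      ≈⟨ sumTo-single (suc k) 1 (s≤s z≤n) others≈0 ⟩
    b 1 0 * powS f k k 1 + b 1 1 * powS f k k 0
      ≈⟨ +-cong (trans (*-cong b₁₀≈1 (powS-f-tᵏx k)) (*-identityˡ _)) (trans (*-congˡ (powS-f-tᵏ k)) (*-identityʳ _)) ⟩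
    fromℕ k * b 1 1 + b 1 1
      ≈⟨ fromℕ-suc-* k (b 1 1) ⟩
    fromℕ (suc k) * b 1 1 ∎
    where
    others≈0 : ∀ a → a ≤ℕ suc k → a ≢ 1 → f a 0 * powS f k (suc k ∸ a) 1 + f a 1 * powS f k (suc k ∸ a) 0 ≈ 0#
    others≈0 zero          _   _   = trans (+-cong (zeroˡ _) (zeroˡ _)) 0#+0#≈0#
    others≈0 (suc zero)    _   a≢1 = ⊥-elim (a≢1 ≡.refl)
    others≈0 (suc (suc a)) a≤m _   = trans (+-cong (low 0 1) (low 1 0)) 0#+0#≈0#
      where
      low : ∀ e n → f (suc (suc a)) e * powS f k (suc k ∸ suc (suc a)) n ≈ 0#
      low e n = f*powS-f-lowOrder k (suc k) e n 1 (suc (suc a)) (ℕ.≤-reflexive (ℕ.+-comm 1 k)) (s≤s (s≤s z≤n)) a≤m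

  powS-f-tᵏ⁺¹ : ∀ k → powS f k (suc k) 0 ≈ fromℕ k * b 2 0
  powS-f-tᵏ⁺¹ zero    = sym (zeroˡ _)
  powS-f-tᵏ⁺¹ (suc k) = begin
    sumTo (suc (suc k)) (λ a → f a 0 * powS f k (suc (suc k) ∸ a) 0)
      ≈⟨ sumTo-pair (suc (suc k)) 1 2 (λ ()) (s≤s z≤n) (s≤s (s≤s z≤n)) others≈0 ⟩
    b 1 0 * powS f k (suc k) 0 + b 2 0 * powS f k k 0
      ≈⟨ +-cong (trans (*-cong b₁₀≈1 (powS-f-tᵏ⁺¹ k)) (*-identityˡ _)) (trans (*-congˡ (powS-f-tᵏ k)) (*-identityʳ _)) ⟩
    fromℕ k * b 2 0 + b 2 0
      ≈⟨ fromℕ-suc-* k (b 2 0) ⟩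
    fromℕ (suc k) * b 2 0 ∎
    where
    others≈0 : ∀ a → a ≤ℕ suc (suc k) → a ≢ 1 → a ≢ 2 → f a 0 * powS f k (suc (suc k) ∸ a) 0 ≈ 0#
    others≈0 zero                _   _   _   = zeroˡ _
    others≈0 (suc zero)          _   a≢1 _   = ⊥-elim (a≢1 ≡.refl)
    others≈0 (suc (suc zero))    _   _   a≢2 = ⊥-elim (a≢2 ≡.refl)
    others≈0 (suc (suc (suc a))) a≤m _   _   =
      f*powS-f-lowOrder k (suc (suc k)) 0 0 2 (suc (suc (suc a))) (ℕ.≤-reflexive (ℕ.+-comm 2 k)) (s≤s (s≤s (s≤s z≤n))) a≤m

  -- [tᵐxⁿ] of φₖₗ xˡ tᵏ (1 + k b₁₁ x + k b₂₀ t), the part of φₖₗ xˡ fᵏ seen in total degree ≤ k + l + 1.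
  lowTerm : Series → ℕ → ℕ → ℕ → ℕ → Carrier
  lowTerm φ m n k l = δ k m (δ l n 1#) * φ k l
                    + (δ k m (δ (suc l) n 1#) * (φ k l * (fromℕ k * b 1 1))
                    +  δ (suc k) m (δ l n 1#) * (φ k l * (fromℕ k * b 2 0)))

  δ²-refl : ∀ k l x → δ k k (δ l l 1#) * x ≈ x
  δ²-refl k l x = trans (*-congʳ (reflexive (≡.trans (δ-refl k _) (δ-refl l 1#)))) (*-identityˡ x)

  δ²-≢₁ : ∀ k k′ l l′ x → k ≢ k′ → δ k k′ (δ l l′ 1#) * x ≈ 0#
  δ²-≢₁ k k′ l l′ x k≢k′ = trans (*-congʳ (reflexive (δ-≢ k k′ _ k≢k′))) (zeroˡ x)

  δ²-≢₂ : ∀ k l l′ x → l ≢ l′ → δ k k (δ l l′ 1#) * x ≈ 0#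
  δ²-≢₂ k l l′ x l≢l′ = trans (*-congʳ (reflexive (≡.trans (δ-refl k _) (δ-≢ l l′ 1# l≢l′)))) (zeroˡ x)

  lowTerm-≈0 : ∀ φ m n k l → φ k l ≈ 0# → lowTerm φ m n k l ≈ 0#
  lowTerm-≈0 φ m n k l φₖₗ≈0 = trans
    (+-cong (trans (*-congˡ φₖₗ≈0) (zeroʳ _))
            (+-cong (trans (*-congˡ (trans (*-congʳ φₖₗ≈0) (zeroˡ _))) (zeroʳ _))
                    (trans (*-congˡ (trans (*-congʳ φₖₗ≈0) (zeroˡ _))) (zeroʳ _))))
    (trans (+-congˡ 0#+0#≈0#) 0#+0#≈0#)

  lowTerm-1 : ∀ φ m n → lowTerm φ m n m n ≈ φ m n
  lowTerm-1 φ m n = trans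
    (+-cong (δ²-refl m n _) (+-cong (δ²-≢₂ m (suc n) n _ ℕ.1+n≢n) (δ²-≢₁ (suc m) m n n _ ℕ.1+n≢n)))
    (trans (+-congˡ 0#+0#≈0#) (+-identityʳ _))

  lowTerm-x : ∀ φ m l → lowTerm φ m (suc l) m l ≈ φ m l * (fromℕ m * b 1 1)
  lowTerm-x φ m l = trans
    (+-cong (δ²-≢₂ m l (suc l) _ (ℕ.1+n≢n ∘ ≡.sym)) (+-cong (δ²-refl m (suc l) _) (δ²-≢₁ (suc m) m l (suc l) _ ℕ.1+n≢n)))
    (trans (+-identityˡ _) (+-identityʳ _))

  lowTerm-t : ∀ φ k l → lowTerm φ (suc k) l k l ≈ φ k l * (fromℕ k * b 2 0)
  lowTerm-t φ k l = trans
    (+-cong (δ²-≢₁ k (suc k) l l _ (ℕ.1+n≢n ∘ ≡.sym))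
            (+-cong (δ²-≢₁ k (suc k) (suc l) l _ (ℕ.1+n≢n ∘ ≡.sym)) (δ²-refl (suc k) l _)))
    (trans (+-identityˡ _) (+-identityˡ _))

  compS-f-summand : ∀ d φ → (∀ k l → k +ℕ l ≤ℕ d → φ k l ≈ 0#) → ∀ m n k l → m +ℕ n ≤ℕ suc (suc d) →
    k ≤ℕ m → l ≤ℕ n → φ k l * powS f k m (n ∸ l) ≈ lowTerm φ m n k l
  compS-f-summand d φ φ≈0 m n k l m+n≤ k≤m l≤n with k +ℕ l ℕ.≤? d
  ... | yes k+l≤d = trans (trans (*-congʳ (φ≈0 k l k+l≤d)) (zeroˡ _)) (sym (lowTerm-≈0 φ m n k l (φ≈0 k l k+l≤d)))
  ... | no k+l≰d with nearDiagonal k≤m l≤n (ℕ.≤-trans m+n≤ (s≤s (ℕ.≰⇒> k+l≰d)))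
  ...   | inj₁ (≡.refl , ≡.refl) = begin
    φ k l * powS f k k (l ∸ l)  ≡⟨ ≡.cong (λ e → φ k l * powS f k k e) (ℕ.n∸n≡0 l) ⟩
    φ k l * powS f k k 0        ≈⟨ trans (*-congˡ (powS-f-tᵏ k)) (*-identityʳ _) ⟩
    φ k l                       ≈⟨ lowTerm-1 φ k l ⟨
    lowTerm φ k l k l           ∎
  ...   | inj₂ (inj₁ (≡.refl , ≡.refl)) = begin
    φ k l * powS f k k (suc l ∸ l)  ≡⟨ ≡.cong (λ e → φ k l * powS f k k e) (ℕ.m+n∸n≡m 1 l) ⟩
    φ k l * powS f k k 1            ≈⟨ *-congˡ (powS-f-tᵏx k) ⟩
    φ k l * (fromℕ k * b 1 1)       ≈⟨ lowTerm-x φ k l ⟨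
    lowTerm φ k (suc l) k l         ∎
  ...   | inj₂ (inj₂ (≡.refl , ≡.refl)) = begin
    φ k l * powS f k (suc k) (l ∸ l)  ≡⟨ ≡.cong (λ e → φ k l * powS f k (suc k) e) (ℕ.n∸n≡0 l) ⟩
    φ k l * powS f k (suc k) 0        ≈⟨ *-congˡ (powS-f-tᵏ⁺¹ k) ⟩
    φ k l * (fromℕ k * b 2 0)         ≈⟨ lowTerm-t φ k l ⟨
    lowTerm φ (suc k) l k l           ∎

  shiftX shiftT : Series → Series
  shiftX φ m zero    = 0#
  shiftX φ m (suc n) = φ m n * (fromℕ m * b 1 1)
  shiftT φ zero    n = 0#
  shiftT φ (suc m) n = φ m n * (fromℕ m * b 2 0)

  compS-f-low : ∀ d φ → (∀ k l → k +ℕ l ≤ℕ d → φ k l ≈ 0#) → ∀ m n → m +ℕ n ≤ℕ suc (suc d) →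
    compS φ f m n ≈ φ m n + (shiftX φ m n + shiftT φ m n)
  compS-f-low d φ φ≈0 m n m+n≤ = begin
    compS φ f m n
      ≈⟨ sumTo-cong≤ m (λ k k≤m → sumTo-cong≤ n (λ l l≤n → compS-f-summand d φ φ≈0 m n k l m+n≤ k≤m l≤n)) ⟩
    sumTo m (λ k → sumTo n (lowTerm φ m n k))
      ≈⟨ sumTo-cong m (λ k → trans (sumTo-+ n _ _) (+-congˡ (sumTo-+ n _ _))) ⟩
    sumTo m (λ k → sumTo n (λ l → δ k m (δ l n 1#) * φ k l)
                 + (sumTo n (λ l → δ k m (δ (suc l) n 1#) * (φ k l * (fromℕ k * b 1 1)))
                 +  sumTo n (λ l → δ (suc k) m (δ l n 1#) * (φ k l * (fromℕ k * b 2 0)))))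
      ≈⟨ trans (sumTo-+ m _ _) (+-congˡ (sumTo-+ m _ _)) ⟩
    sumTo m (λ k → sumTo n (λ l → δ k m (δ l n 1#) * φ k l))
      + (sumTo m (λ k → sumTo n (λ l → δ k m (δ (suc l) n 1#) * (φ k l * (fromℕ k * b 1 1))))
      +  sumTo m (λ k → sumTo n (λ l → δ (suc k) m (δ l n 1#) * (φ k l * (fromℕ k * b 2 0)))))
      ≈⟨ +-cong (trans (sumTo²-δ m n m n 1# φ ℕ.≤-refl ℕ.≤-refl) (*-identityˡ _)) (+-cong (x-part m n) (t-part m n)) ⟩
    φ m n + (shiftX φ m n + shiftT φ m n) ∎
    where
    x-part : ∀ m n →
      sumTo m (λ k → sumTo n (λ l → δ k m (δ (suc l) n 1#) * (φ k l * (fromℕ k * b 1 1)))) ≈ shiftX φ m n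
    x-part m zero    = sumTo-≈0 m (λ k _ → trans (*-congʳ (δ-0# k m)) (zeroˡ _))
    x-part m (suc n) = trans (sumTo²-δ m (suc n) m n 1# (λ k l → φ k l * (fromℕ k * b 1 1)) ℕ.≤-refl (ℕ.n≤1+n n))
                             (*-identityˡ _)
    t-part : ∀ m n →
      sumTo m (λ k → sumTo n (λ l → δ (suc k) m (δ l n 1#) * (φ k l * (fromℕ k * b 2 0)))) ≈ shiftT φ m n
    t-part zero    n = sumTo-≈0 n (λ l _ → zeroˡ _)
    t-part (suc m) n = trans (sumTo²-δ (suc m) n m n 1# (λ k l → φ k l * (fromℕ k * b 2 0)) (ℕ.n≤1+n m) ℕ.≤-refl)
                             (*-identityˡ _)

  ψ : ℕ → Series
  ψ zero    = tS
  ψ (suc k) = compS (ψ k) f S.- ψ k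

  ψ-suc≈shifts : ∀ k → (∀ m n → m +ℕ n ≤ℕ k → ψ k m n ≈ 0#) → ∀ m n → m +ℕ n ≤ℕ suc (suc k) →
    ψ (suc k) m n ≈ shiftX (ψ k) m n + shiftT (ψ k) m n
  ψ-suc≈shifts k ψₖ≈0 m n m+n≤ = begin
    compS (ψ k) f m n - ψ k m n      ≈⟨ +-congʳ (compS-f-low k (ψ k) ψₖ≈0 m n m+n≤) ⟩
    (ψ k m n + shifts) - ψ k m n     ≈⟨ +-congʳ (+-comm _ _) ⟩
    (shifts + ψ k m n) - ψ k m n     ≈⟨ +-assoc _ _ _ ⟩
    shifts + (ψ k m n - ψ k m n)     ≈⟨ +-congˡ (-‿inverseʳ _) ⟩
    shifts + 0#                      ≈⟨ +-identityʳ _ ⟩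
    shifts                           ∎
    where
    shifts : Carrier
    shifts = shiftX (ψ k) m n + shiftT (ψ k) m n

  ψ-vanishes : ∀ k m n → m +ℕ n ≤ℕ k → ψ k m n ≈ 0#
  ψ-vanishes zero    zero zero _ = refl
  ψ-vanishes (suc k) m n m+n≤ =
    trans (ψ-suc≈shifts k (ψ-vanishes k) m n (ℕ.m≤n⇒m≤1+n m+n≤))
          (trans (+-cong (x-part m n m+n≤) (t-part m n m+n≤)) 0#+0#≈0#)
    where
    x-part : ∀ m n → m +ℕ n ≤ℕ suc k → shiftX (ψ k) m n ≈ 0#
    x-part m zero    _    = refl
    x-part m (suc n) m+n≤ =
      trans (*-congʳ (ψ-vanishes k m n (ℕ.≤-pred (≡.subst (_≤ℕ suc k) (ℕ.+-suc m n) m+n≤)))) (zeroˡ _)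
    t-part : ∀ m n → m +ℕ n ≤ℕ suc k → shiftT (ψ k) m n ≈ 0#
    t-part zero    n _           = refl
    t-part (suc m) n (s≤s m+n≤) = trans (*-congʳ (ψ-vanishes k m n m+n≤)) (zeroˡ _)

  leadingCoeff : ℕ → Series
  leadingCoeff k zero    n = 0#
  leadingCoeff k (suc m) n = fromℕ (m ! *ℕ S (suc k) (suc m)) * ((b 2 0 ^ m) * (b 1 1 ^ n))

  shiftX-leadingCoeff : ∀ k m n → suc m +ℕ n ≡ suc (suc k) →
    shiftX (leadingCoeff k) (suc m) n ≈ fromℕ (m ! *ℕ (suc m *ℕ S (suc k) (suc m))) * ((b 2 0 ^ m) * (b 1 1 ^ n))
  shiftX-leadingCoeff k m zero    m+0≡ = sym (trans (*-congʳ (reflexive (≡.cong fromℕ coeff≡0))) (zeroˡ _))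
    where
    coeff≡0 : m ! *ℕ (suc m *ℕ S (suc k) (suc m)) ≡ 0
    coeff≡0 rewrite ℕ.+-identityʳ m | ℕ.suc-injective m+0≡ | S-beyond (suc k) (suc (suc k)) (ℕ.n<1+n (suc k))
                  | ℕ.*-zeroʳ (suc (suc k)) = ℕ.*-zeroʳ (suc k !)
  shiftX-leadingCoeff k m (suc n) _ = begin
    fromℕ (m ! *ℕ Sₖ) * ((b 2 0 ^ m) * (b 1 1 ^ n)) * (fromℕ (suc m) * b 1 1)
      ≈⟨ solve 5 (λ F Q X c e → (F :* (Q :* X)) :* (c :* e) := (c :* F) :* (Q :* (e :* X))) refl
               (fromℕ (m ! *ℕ Sₖ)) (b 2 0 ^ m) (b 1 1 ^ n) (fromℕ (suc m)) (b 1 1) ⟩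
    fromℕ (suc m) * fromℕ (m ! *ℕ Sₖ) * ((b 2 0 ^ m) * (b 1 1 ^ suc n))
      ≈⟨ *-congʳ (fromℕ-* (suc m) (m ! *ℕ Sₖ)) ⟨
    fromℕ (suc m *ℕ (m ! *ℕ Sₖ)) * ((b 2 0 ^ m) * (b 1 1 ^ suc n))
      ≡⟨ ≡.cong (λ e → fromℕ e * ((b 2 0 ^ m) * (b 1 1 ^ suc n))) (ℕ*.x∙yz≈y∙xz (suc m) (m !) Sₖ) ⟩
    fromℕ (m ! *ℕ (suc m *ℕ Sₖ)) * ((b 2 0 ^ m) * (b 1 1 ^ suc n)) ∎
    where
    open import Algebra.Solver.Ring.NaturalCoefficients.Default commutativeSemiring
    module ℕ* = Algebra.Properties.CommutativeSemigroup ℕ.*-commutativeSemigroup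
    Sₖ : ℕ
    Sₖ = S (suc k) (suc m)

  shiftT-leadingCoeff : ∀ k m n →
    shiftT (leadingCoeff k) (suc m) n ≈ fromℕ (m ! *ℕ S (suc k) m) * ((b 2 0 ^ m) * (b 1 1 ^ n))
  shiftT-leadingCoeff k zero    n = trans (zeroˡ _) (sym (zeroˡ _))
  shiftT-leadingCoeff k (suc m) n = begin
    fromℕ (m ! *ℕ Sₖ) * ((b 2 0 ^ m) * (b 1 1 ^ n)) * (fromℕ (suc m) * b 2 0)
      ≈⟨ solve 5 (λ F Q X c e → (F :* (Q :* X)) :* (c :* e) := (c :* F) :* ((e :* Q) :* X)) refl
               (fromℕ (m ! *ℕ Sₖ)) (b 2 0 ^ m) (b 1 1 ^ n) (fromℕ (suc m)) (b 2 0) ⟩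
    fromℕ (suc m) * fromℕ (m ! *ℕ Sₖ) * ((b 2 0 ^ suc m) * (b 1 1 ^ n))
      ≈⟨ *-congʳ (fromℕ-* (suc m) (m ! *ℕ Sₖ)) ⟨
    fromℕ (suc m *ℕ (m ! *ℕ Sₖ)) * ((b 2 0 ^ suc m) * (b 1 1 ^ n))
      ≡⟨ ≡.cong (λ e → fromℕ e * ((b 2 0 ^ suc m) * (b 1 1 ^ n))) (ℕ.*-assoc (suc m) (m !) Sₖ) ⟨
    fromℕ (suc m ! *ℕ Sₖ) * ((b 2 0 ^ suc m) * (b 1 1 ^ n)) ∎
    where
    open import Algebra.Solver.Ring.NaturalCoefficients.Default commutativeSemiring
    Sₖ : ℕ
    Sₖ = S (suc k) (suc m)

  -- Stirling recurrence: S(k + 2, m + 1) = (m + 1) S(k + 1, m + 1) + S(k + 1, m).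
  leadingCoeff-suc : ∀ k m n → m +ℕ n ≡ suc (suc k) →
    shiftX (leadingCoeff k) m n + shiftT (leadingCoeff k) m n ≈ leadingCoeff (suc k) m n
  leadingCoeff-suc k zero    zero    _ = 0#+0#≈0#
  leadingCoeff-suc k zero    (suc n) _ = trans (+-identityʳ _) (zeroˡ _)
  leadingCoeff-suc k (suc m) n m+n≡ = begin
    shiftX (leadingCoeff k) (suc m) n + shiftT (leadingCoeff k) (suc m) n
      ≈⟨ +-cong (shiftX-leadingCoeff k m n m+n≡) (shiftT-leadingCoeff k m n) ⟩
    fromℕ (m ! *ℕ (suc m *ℕ S (suc k) (suc m))) * P + fromℕ (m ! *ℕ S (suc k) m) * P
      ≈⟨ distribʳ P _ _ ⟨
    (fromℕ (m ! *ℕ (suc m *ℕ S (suc k) (suc m))) + fromℕ (m ! *ℕ S (suc k) m)) * P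
      ≈⟨ *-congʳ (fromℕ-+ (m ! *ℕ (suc m *ℕ S (suc k) (suc m))) (m ! *ℕ S (suc k) m)) ⟨
    fromℕ (m ! *ℕ (suc m *ℕ S (suc k) (suc m)) +ℕ m ! *ℕ S (suc k) m) * P
      ≡⟨ ≡.cong (λ e → fromℕ e * P) (ℕ.*-distribˡ-+ (m !) (suc m *ℕ S (suc k) (suc m)) (S (suc k) m)) ⟨
    leadingCoeff (suc k) (suc m) n ∎
    where
    P : Carrier
    P = (b 2 0 ^ m) * (b 1 1 ^ n)

  ψ-leading : ∀ k m n → m +ℕ n ≡ suc k → ψ k m n ≈ leadingCoeff k m n
  ψ-leading zero    zero       (suc zero) ≡.refl = refl
  ψ-leading zero    (suc zero) zero       ≡.refl = sym (trans (*-cong (+-identityʳ 1#) (*-identityˡ 1#)) (*-identityˡ 1#))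
  ψ-leading (suc k) m n m+n≡ = begin
    ψ (suc k) m n                                              ≈⟨ ψ-suc≈shifts k (ψ-vanishes k) m n (ℕ.≤-reflexive m+n≡) ⟩
    shiftX (ψ k) m n + shiftT (ψ k) m n                        ≈⟨ +-cong (x-part m n m+n≡) (t-part m n m+n≡) ⟩
    shiftX (leadingCoeff k) m n + shiftT (leadingCoeff k) m n  ≈⟨ leadingCoeff-suc k m n m+n≡ ⟩
    leadingCoeff (suc k) m n                                   ∎
    where
    x-part : ∀ m n → m +ℕ n ≡ suc (suc k) → shiftX (ψ k) m n ≈ shiftX (leadingCoeff k) m n
    x-part m zero    _    = refl
    x-part m (suc n) m+n≡ = *-congʳ (ψ-leading k m n (ℕ.suc-injective (≡.trans (≡.sym (ℕ.+-suc m n)) m+n≡)))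
    t-part : ∀ m n → m +ℕ n ≡ suc (suc k) → shiftT (ψ k) m n ≈ shiftT (leadingCoeff k) m n
    t-part zero    n _    = refl
    t-part (suc m) n m+n≡ = *-congʳ (ψ-leading k m n (ℕ.suc-injective m+n≡))

  diagCoeff-ψ-below : ∀ k j → j <ℕ k → diagCoeff (ψ k) (suc j) ≈ 0#
  diagCoeff-ψ-below k j j<k =
    sumTo-≈0 (suc j) (λ m m≤ → ψ-vanishes k m (suc j ∸ m) (≡.subst (_≤ℕ k) (≡.sym (ℕ.m+[n∸m]≡n m≤)) j<k))

  diagCoeff-ψ-diag : ∀ k → diagCoeff (ψ k) (suc k) ≈ factor b k
  diagCoeff-ψ-diag k = begin
    sumTo (suc k) (λ m → ψ k m (suc k ∸ m))
      ≈⟨ sumTo-cong≤ (suc k) (λ m m≤ → ψ-leading k m (suc k ∸ m) (ℕ.m+[n∸m]≡n m≤)) ⟩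
    sumTo (suc k) (λ m → leadingCoeff k m (suc k ∸ m))  ≈⟨ sumTo-suc k _ ⟩
    0# + factor b k                                      ≈⟨ +-identityˡ _ ⟩
    factor b k                                           ∎

  factor-0≈1# : factor b 0 ≈ 1#
  factor-0≈1# = trans (*-cong (+-identityʳ 1#) (*-identityˡ 1#)) (*-identityˡ 1#)

  NoTFreeTerm-iter : ∀ i → NoTFreeTerm (iter b i)
  NoTFreeTerm-iter zero    = NoTFreeTerm-tS
  NoTFreeTerm-iter (suc i) = NoTFreeTerm-compS f (iter b i) (NoTFreeTerm-fS b)

  open Determinant R using (fwdDiff)

  fwdDiff-cMat : ∀ k i j → fwdDiff k (cMat b) i j ≈ diagCoeff (compS (ψ k) (iter b i)) (suc j)
  fwdDiff-cMat zero    i j = sym (diagCoeff-cong (suc j) (compS-identityˡ (iter b i) (NoTFreeTerm-iter i)))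
  fwdDiff-cMat (suc k) i j = begin
    fwdDiff k (cMat b) (suc i) j - fwdDiff k (cMat b) i j
      ≈⟨ +-cong (fwdDiff-cMat k (suc i) j) (-‿cong (fwdDiff-cMat k i j)) ⟩
    diagCoeff (compS (ψ k) (compS f (iter b i))) (suc j) - diagCoeff (compS (ψ k) (iter b i)) (suc j)
      ≈⟨ diagCoeff-sub (compS (ψ k) (compS f (iter b i))) (compS (ψ k) (iter b i)) (suc j) ⟨
    diagCoeff (compS (ψ k) (compS f (iter b i)) S.- compS (ψ k) (iter b i)) (suc j)
      ≈⟨ diagCoeff-cong (suc j) (λ m n → +-congʳ { - compS (ψ k) (iter b i) m n}
           (compS-assoc (ψ k) f (iter b i) (NoTFreeTerm-fS b) (NoTFreeTerm-iter i) m n)) ⟨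
    diagCoeff (compS (compS (ψ k) f) (iter b i) S.- compS (ψ k) (iter b i)) (suc j)
      ≈⟨ diagCoeff-cong (suc j) (compS-sub (compS (ψ k) f) (ψ k) (iter b i)) ⟨
    diagCoeff (compS (ψ (suc k)) (iter b i)) (suc j) ∎

  fwdDiff-cMat-row₀ : ∀ k j → fwdDiff k (cMat b) 0 j ≈ diagCoeff (ψ k) (suc j)
  fwdDiff-cMat-row₀ k j = trans (fwdDiff-cMat k 0 j) (diagCoeff-cong (suc j) (compS-identityʳ (ψ k)))

theorem3 : {c ℓ : Level} (R : CommutativeRing c ℓ) (b : ℕ → ℕ → CommutativeRing.Carrier R) →
    CommutativeRing._≈_ R (b 1 0) (CommutativeRing.1# R) →
    (n : ℕ) →
    CommutativeRing._≈_ R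
    (PS.det R (suc n) (λ i j → PS.cMat R b (toℕ i) (toℕ j)))
    (PS.prod1 R n (PS.factor R b))
theorem3 R b b₁₀≈1 n = begin
  det (suc n) (λ i j → cMat b (toℕ i) (toℕ j))  ≈⟨ det-fwdDiff n (cMat b) ⟩
  det (suc n) (λ i j → U (toℕ i) (toℕ j))       ≈⟨ det-upperTriangular n U U-below ⟩
  U 0 0 * prod1 n (λ k → U k k)                 ≈⟨ *-cong (trans (U-diag 0) factor-0≈1#) (prod1-cong n U-diag) ⟩
  1# * prod1 n (factor b)                       ≈⟨ *-identityˡ _ ⟩
  prod1 n (factor b)                            ∎
  where
  open CommutativeRing R
  open PS R
  open Sums R
  open Determinant R
  open Iterates R b b₁₀≈1
  open import Relation.Binary.Reasoning.Setoid setoid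
  U : ℕ → ℕ → Carrier
  U i j = fwdDiff i (cMat b) 0 j
  U-below : ∀ i j → j <ℕ i → U i j ≈ 0#
  U-below i j j<i = trans (fwdDiff-cMat-row₀ i j) (diagCoeff-ψ-below i j j<i)
  U-diag : ∀ k → U k k ≈ factor b k
  U-diag k = trans (fwdDiff-cMat-row₀ k k) (diagCoeff-ψ-diag k)
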